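{- Let $p$ be an odd prime and $k\ge 1$ an integer, and let $n=2p^k$. Then $t(n)\ge n-2k-2$.
   Context: A cyclic permutation of order $n$ is a bijective labeling of the vertices of a cycle of length $n$ by the elements of $[n]$, up to rotation of the cycle (reflections are not identified). A swap exchanges the labels of any two (not necessarily adjacent) vertices. $t(n)$ is the maximum, over all cyclic permutations of order $n$, of the minimum number of swaps needed to transform it into the trivial cyclic permutation $(1,2,\ldots,n)$ (labels $1,\ldots,n$ consecutively in order around the cycle). Equivalently, with $c=(1,2,\ldots,n)\in S_n$, $C_n=\langle c\rangle$ and $\operatorname{cyc}(\sigma)$ the number of cycles of $\sigma\in S_n$ (fixed points included), $t(n)=\max_{\pi\in S_n}\min_{\sigma\in\pi C_n}(n-\operatorname{cyc}(\sigma))$. -}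

module Defs where

open import Data.Nat using (ℕ; zero; suc; _+_; _∸_; _%_; _≤ᵇ_; _⊔_; _⊓_)
open import Data.Nat.DivMod using (m%n<n)
open import Data.Fin using (Fin; toℕ; fromℕ<)
open import Data.Vec using (Vec; []; _∷_; lookup; allFin)
open import Data.List using (List; []; _∷_; _++_; map; concatMap; foldr; upTo; filter; length)
open import Data.Bool using (Bool; true; false; _∧_)
open import Function using (_∘_)

insertAll : ∀ {A : Set} {n} → A → Vec A n → List (Vec A (suc n))
insertAll x [] = (x ∷ []) ∷ []
insertAll x (y ∷ ys) = (x ∷ y ∷ ys) ∷ map (y ∷_) (insertAll x ys)

vperms : ∀ {A : Set} {n} → Vec A n → List (Vec A n)
vperms [] = [] ∷ []
vperms (x ∷ xs) = concatMap (insertAll x) (vperms xs)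

allPerms : (n : ℕ) → List (Fin n → Fin n)
allPerms n = map lookup (vperms (allFin n))

-- c^j where c = (0 1 2 … n-1) is the n-cycle i ↦ i+1 mod n
cpow : ∀ {n} → ℕ → Fin n → Fin n
cpow {suc m} j i = fromℕ< (m%n<n (toℕ i + j) (suc m))

iter : ∀ {n} → (Fin n → Fin n) → ℕ → Fin n → Fin n
iter σ zero i = i
iter σ (suc j) i = σ (iter σ j i)

isCycleMin : ∀ {n} → (Fin n → Fin n) → Fin n → Bool
isCycleMin {n} σ i = foldr _∧_ true (map (λ j → toℕ i ≤ᵇ toℕ (iter σ j i)) (upTo n))

-- number of cycles of σ (fixed points included) = number of cycle minima
cyc : ∀ {n} → (Fin n → Fin n) → ℕ
cyc {n} σ = foldr (λ i acc → (if isCycleMin σ i then 1 else 0) + acc) 0 (Data.List.allFin n)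
  where open import Data.Bool using (if_then_else_)
        import Data.List

-- min over σ ∈ π C_n of (n - cyc σ);  π C_n = { π ∘ c^j | 0 ≤ j < n }
-- (for n ≥ 1 the list of j is nonempty; n - cyc σ ≤ n so the initial value n is harmless)
minSwaps : ∀ {n} → (Fin n → Fin n) → ℕ
minSwaps {n} π = foldr _⊓_ n (map (λ j → n ∸ cyc (π ∘ cpow j)) (upTo n))

t : ℕ → ℕ
t n = foldr _⊔_ 0 (map minSwaps (allPerms n))

{-# OPTIONS --safe #-}
module Submission where

-- Let q = p ^ k and n = 2q. Take an odd a whose powers reach every unit modulo q: a
-- primitive root modulo p (an element of maximal order, by Lagrange's bound on the roots
-- of X^e − 1) lifted to q, which works because p is odd. Being odd, a is also invertible
-- modulo n, so π(x) = a·x mod n is a permutation. For a rotation c^j the map σ = π ∘ c^j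
-- sends y to a(y + j), and κ(y) = (a − 1)y + aj satisfies κ(σ y) ≡ a·κ(y) (mod q). Every
-- orbit of multiplication by a on ℤ/q contains some p^i with i ≤ k, so every cycle of σ
-- contains a point y with κ(y) ≡ p^i; as a − 1 is invertible modulo q, such a point is
-- determined by i and by the half of ℤ/n containing it. Hence σ has at most 2(k + 1)
-- cycles, for every j.

open import Data.Nat.Base as ℕ using (ℕ; _≤_)
import Data.Nat.Properties as ℕ
import Data.Nat.Divisibility as ℕ
open import Data.Nat.Primality using (Prime)
open import Data.Integer.Base using (ℤ; +_)
import Data.Integer.Properties as ℤ
open import Data.Integer.Tactic.RingSolver using (solve-∀)
open import Data.Empty using (⊥-elim)
open import Data.Product using (∃-syntax; ∃₂; _×_; _,_; proj₁; proj₂)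
open import Data.Sum using (_⊎_; inj₁; inj₂; [_,_]′)
open import Function using (_∘_)
open import Function.Definitions using (Injective)
open import Relation.Nullary using (¬_; Dec; yes; no)
open import Relation.Nullary.Decidable using (decidable-stable; T?)
open import Relation.Nullary.Negation using (contradiction)
open import Relation.Binary.PropositionalEquality

module IntegerCongruence where

  open import Data.Nat as ℕ using (zero; suc; NonZero)
  open import Data.Integer using (_+_; _-_; -_; _*_; _^_; 0ℤ; 1ℤ; ∣_∣; _%ℕ_; _/ℕ_)
  open import Data.Integer.DivMod using (a≡a%ℕn+[a/ℕn]*n)
  open import Data.Integer.Divisibility.Signed
  import Relation.Nullary.Decidable as Dec
  open import Relation.Binary.Bundles using (Setoid)
  open import Relation.Binary.Structures using (IsEquivalence)
  import Relation.Binary.Reasoning.Setoid as SetoidReasoning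

  infix 4 _≡_mod_
  record _≡_mod_ (x y m : ℤ) : Set where
    constructor congruent
    field difference : m ∣ x - y
  open _≡_mod_ public

  module _ {m : ℤ} where

    ≡-mod-reflexive : ∀ {x y} → x ≡ y → x ≡ y mod m
    ≡-mod-reflexive {x} refl = congruent (divides 0ℤ (ℤ.+-inverseʳ x))

    ≡-mod-refl : ∀ {x} → x ≡ x mod m
    ≡-mod-refl = ≡-mod-reflexive refl

    ≡-mod-sym : ∀ {x y} → x ≡ y mod m → y ≡ x mod m
    ≡-mod-sym {x} {y} (congruent m∣x-y) = congruent (subst (m ∣_) (negate x y) (∣m⇒∣-m m∣x-y))
      where
      negate : ∀ x y → - (x - y) ≡ y - x
      negate = solve-∀

    ≡-mod-trans : ∀ {x y z} → x ≡ y mod m → y ≡ z mod m → x ≡ z mod m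
    ≡-mod-trans {x} {y} {z} (congruent m∣x-y) (congruent m∣y-z) =
      congruent (subst (m ∣_) (telescope x y z) (∣m∣n⇒∣m+n m∣x-y m∣y-z))
      where
      telescope : ∀ x y z → (x - y) + (y - z) ≡ x - z
      telescope = solve-∀

    ≡-mod-isEquivalence : IsEquivalence (λ x y → x ≡ y mod m)
    ≡-mod-isEquivalence = record { refl = ≡-mod-refl ; sym = ≡-mod-sym ; trans = ≡-mod-trans }

  ≡-mod-setoid : ℤ → Setoid _ _
  ≡-mod-setoid m = record { isEquivalence = ≡-mod-isEquivalence {m} }

  module ≡-mod-Reasoning (m : ℤ) = SetoidReasoning (≡-mod-setoid m)

  module _ {m : ℤ} where

    +-cong-mod : ∀ {x y u v} → x ≡ y mod m → u ≡ v mod m → x + u ≡ y + v mod m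
    +-cong-mod {x} {y} {u} {v} (congruent m∣x-y) (congruent m∣u-v) =
      congruent (subst (m ∣_) (regroup x y u v) (∣m∣n⇒∣m+n m∣x-y m∣u-v))
      where
      regroup : ∀ x y u v → (x - y) + (u - v) ≡ (x + u) - (y + v)
      regroup = solve-∀

    *-cong-mod : ∀ {x y u v} → x ≡ y mod m → u ≡ v mod m → x * u ≡ y * v mod m
    *-cong-mod {x} {y} {u} {v} (congruent m∣x-y) (congruent m∣u-v) =
      congruent (subst (m ∣_) (regroup x y u v) (∣m∣n⇒∣m+n (∣n⇒∣m*n x m∣u-v) (∣m⇒∣m*n v m∣x-y)))
      where
      regroup : ∀ x y u v → x * (u - v) + (x - y) * v ≡ x * u - y * v
      regroup = solve-∀

    +-congˡ-mod : ∀ z {x y} → x ≡ y mod m → z + x ≡ z + y mod m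
    +-congˡ-mod z = +-cong-mod (≡-mod-refl {x = z})

    +-congʳ-mod : ∀ z {x y} → x ≡ y mod m → x + z ≡ y + z mod m
    +-congʳ-mod z x≡y = +-cong-mod x≡y (≡-mod-refl {x = z})

    *-congˡ-mod : ∀ z {x y} → x ≡ y mod m → z * x ≡ z * y mod m
    *-congˡ-mod z = *-cong-mod (≡-mod-refl {x = z})

    *-congʳ-mod : ∀ z {x y} → x ≡ y mod m → x * z ≡ y * z mod m
    *-congʳ-mod z x≡y = *-cong-mod x≡y (≡-mod-refl {x = z})

    +-cancelʳ-mod : ∀ z {x y} → x + z ≡ y + z mod m → x ≡ y mod m
    +-cancelʳ-mod z {x} {y} (congruent m∣) = congruent (subst (m ∣_) (cancel x y z) m∣)
      where
      cancel : ∀ x y z → x + z - (y + z) ≡ x - y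
      cancel = solve-∀

    ^-cong-mod : ∀ {x y} → x ≡ y mod m → ∀ t → x ^ t ≡ y ^ t mod m
    ^-cong-mod x≡y zero    = ≡-mod-refl
    ^-cong-mod x≡y (suc t) = *-cong-mod x≡y (^-cong-mod x≡y t)

    ∣⇒≡0-mod : ∀ {x} → m ∣ x → x ≡ 0ℤ mod m
    ∣⇒≡0-mod {x} m∣x = congruent (subst (m ∣_) (sym (ℤ.+-identityʳ x)) m∣x)

    ≡0-mod⇒∣ : ∀ {x} → x ≡ 0ℤ mod m → m ∣ x
    ≡0-mod⇒∣ {x} (congruent m∣x-0) = subst (m ∣_) (ℤ.+-identityʳ x) m∣x-0

    +-∣ʳ-mod : ∀ x {y} → m ∣ y → x + y ≡ x mod m
    +-∣ʳ-mod x {y} m∣y = congruent (subst (m ∣_) (sym (cancel x y)) m∣y)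
      where
      cancel : ∀ x y → x + y - x ≡ y
      cancel = solve-∀

    +-multiple-mod : ∀ x k → x + k * m ≡ x mod m
    +-multiple-mod x k = +-∣ʳ-mod x (divides k refl)

  ≡-mod? : ∀ {m} x y → Dec (x ≡ y mod m)
  ≡-mod? {m} x y = Dec.map′ congruent difference (m ∣? x - y)

  ≡-mod⇒≡+multiple : ∀ {m x y} (x≡y : x ≡ y mod m) → x ≡ y + quotient (difference x≡y) * m
  ≡-mod⇒≡+multiple {m} {x} {y} (congruent (divides k x-y≡km)) = trans (sym (shift x y)) (cong (_+_ y) x-y≡km)
    where
    shift : ∀ x y → y + (x - y) ≡ x
    shift = solve-∀

  pos-^ : ∀ m k → + (m ℕ.^ k) ≡ (+ m) ^ k
  pos-^ m zero    = refl
  pos-^ m (suc k) = trans (ℤ.pos-* m (m ℕ.^ k)) (cong (+ m *_) (pos-^ m k))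

  ^-distribʳ-* : ∀ x y t → (x * y) ^ t ≡ x ^ t * y ^ t
  ^-distribʳ-* x y zero    = refl
  ^-distribʳ-* x y (suc t) = trans (cong (x * y *_) (^-distribʳ-* x y t)) (interchange x y (x ^ t) (y ^ t))
    where
    interchange : ∀ a b c d → a * b * (c * d) ≡ a * c * (b * d)
    interchange = solve-∀

  *-cancelˡ-mod-inverse : ∀ {m} c a {x y} → c * a ≡ 1ℤ mod m → a * x ≡ a * y mod m → x ≡ y mod m
  *-cancelˡ-mod-inverse {m} c a {x} {y} ca≡1 ax≡ay = begin
    x              ≡⟨ ℤ.*-identityˡ x ⟨
    1ℤ * x         ≈⟨ *-congʳ-mod x ca≡1 ⟨
    c * a * x      ≡⟨ ℤ.*-assoc c a x ⟩
    c * (a * x)    ≈⟨ *-congˡ-mod c ax≡ay ⟩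
    c * (a * y)    ≡⟨ ℤ.*-assoc c a y ⟨
    c * a * y      ≈⟨ *-congʳ-mod y ca≡1 ⟩
    1ℤ * y         ≡⟨ ℤ.*-identityˡ y ⟩
    y              ∎
    where open ≡-mod-Reasoning m

  ≡-mod-∣ : ∀ {d m x y} → d ∣ m → x ≡ y mod m → x ≡ y mod d
  ≡-mod-∣ d∣m (congruent m∣x-y) = congruent (∣-trans d∣m m∣x-y)

  module _ (N : ℕ) .{{_ : NonZero N}} where

    %ℕ-≡-mod : ∀ z → z ≡ + (z %ℕ N) mod + N
    %ℕ-≡-mod z = subst (_≡ + (z %ℕ N) mod + N) (sym (a≡a%ℕn+[a/ℕn]*n z N)) (+-multiple-mod (+ (z %ℕ N)) (z /ℕ N))

    ≡-mod⇒≡ : ∀ {x y} → x ℕ.< N → y ℕ.< N → + x ≡ + y mod + N → x ≡ y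
    ≡-mod⇒≡ {x} {y} x<N y<N (congruent N∣x-y) = ℤ.+-injective (ℤ.i-j≡0⇒i≡j (+ x) (+ y) (ℤ.∣i∣≡0⇒i≡0 distance≡0))
      where
      distance<N : ∣ + x - + y ∣ ℕ.< N
      distance<N = ℕ.≤-<-trans (subst (ℕ._≤ x ℕ.⊔ y) (cong ∣_∣ (sym (ℤ.m-n≡m⊖n x y))) (ℤ.∣m⊝n∣≤m⊔n x y))
                               (ℕ.⊔-lub x<N y<N)
      small-multiple : ∀ d → d ℕ.< N → N ℕ.∣ d → d ≡ 0
      small-multiple zero    _   _   = refl
      small-multiple (suc d) d<N N∣d = ⊥-elim (ℕ.>⇒∤ d<N N∣d)
      distance≡0 : ∣ + x - + y ∣ ≡ 0
      distance≡0 = small-multiple _ distance<N (∣⇒∣ᵤ N∣x-y)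

open IntegerCongruence

module NatArithmetic where

  open import Data.Nat as ℕ using (zero; suc; _*_; _^_; _∸_; _<_; NonZero; >-nonZero; z≤n; s≤s)
  open import Data.Nat.Properties
  open import Data.Nat.Divisibility
  open import Data.Nat.Coprimality as Coprime using (Coprime; coprime-divisor; coprime⇒gcd≡1)
  open import Data.Nat.GCD using (gcd; gcd[m,n]∣m; gcd[m,n]∣n; gcd-greatest)
  open import Data.Nat.LCM using (lcm; lcm-least; gcd*lcm)
  open import Data.Nat.Primality using (prime⇒irreducible; prime⇒nonZero; prime⇒nonTrivial)
  open import Data.Nat.Primality.Factorisation using (factorise)
  open import Data.Nat.Induction using (<-wellFounded)
  open import Induction.WellFounded using (Acc; acc)
  open import Data.List using ([]; _∷_)
  open import Data.List.Relation.Unary.All using (_∷_)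
  open import Data.Nat.ListAction using (product)
  open import Relation.Unary using (Decidable)

  -- The least k < N with P k, and N if there is none.
  first : ∀ {P : ℕ → Set} → Decidable P → ℕ → ℕ
  first P? zero = zero
  first P? (suc N) with P? zero
  ... | yes _ = zero
  ... | no  _ = suc (first (P? ∘ suc) N)

  first-minimal : ∀ {P : ℕ → Set} (P? : Decidable P) N {k} → k < first P? N → ¬ P k
  first-minimal P? (suc N) {k} k<first with P? zero
  first-minimal P? (suc N) {zero}  _             | no ¬P0 = ¬P0
  first-minimal P? (suc N) {suc k} (s≤s k<first) | no _   = first-minimal (P? ∘ suc) N k<first

  first-satisfies : ∀ {P : ℕ → Set} (P? : Decidable P) N {k} → k < N → P k → P (first P? N) × first P? N ≤ k
  first-satisfies P? (suc N) {k} k<N Pk with P? zero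
  ... | yes P0 = P0 , z≤n
  first-satisfies P? (suc N) {zero}  _         P0 | no ¬P0 = ⊥-elim (¬P0 P0)
  first-satisfies P? (suc N) {suc k} (s≤s k<N) Pk | no _ =
    let Pfirst , first≤k = first-satisfies (P? ∘ suc) N k<N Pk in Pfirst , s≤s first≤k

  factor-out : ∀ {q} → 2 ≤ q → ∀ n .{{_ : NonZero n}} → ∃[ s ] ∃[ m ] n ≡ q ^ s * m × ¬ q ∣ m
  factor-out {q} 2≤q n = go n (<-wellFounded n)
    where
    go : ∀ n .{{_ : NonZero n}} → Acc _<_ n → ∃[ s ] ∃[ m ] n ≡ q ^ s * m × ¬ q ∣ m
    go n (acc smaller) with q ∣? n
    ... | no q∤n = 0 , n , sym (*-identityˡ n) , q∤n
    ... | yes (divides c refl) =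
      let instance _ = m*n≢0⇒m≢0 c
          s , m , c≡ , q∤m = go c (smaller (m<m*n c q 2≤q))
      in suc s , m , trans (cong (_* q) c≡) (*-comm-assoc s m) , q∤m
      where
      *-comm-assoc : ∀ s m → q ^ s * m * q ≡ q * q ^ s * m
      *-comm-assoc s m = trans (*-comm (q ^ s * m) q) (sym (*-assoc q (q ^ s) m))

  prime-divisor : ∀ n → 2 ≤ n → ∃[ q ] Prime q × q ∣ n
  prime-divisor n 2≤n with factorise n {{>-nonZero (<-trans (s≤s z≤n) 2≤n)}}
  ... | record { factors = [] ; isFactorisation = n≡1 } = ⊥-elim (<⇒≢ 2≤n (sym n≡1))
  ... | record { factors = q ∷ qs ; isFactorisation = n≡ ; factorsPrime = q-prime ∷ _ } =
    q , q-prime , divides (product qs) (trans n≡ (*-comm q (product qs)))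

  prime∤⇒coprime : ∀ {q n} → Prime q → ¬ q ∣ n → Coprime q n
  prime∤⇒coprime q-prime q∤n {d} (d∣q , d∣n) with prime⇒irreducible q-prime d∣q
  ... | inj₁ d≡1 = d≡1
  ... | inj₂ refl = ⊥-elim (q∤n d∣n)

  coprime-^ : ∀ {q n} → Coprime q n → ∀ s → Coprime (q ^ s) n
  coprime-^ q⊥n zero    = Coprime.1-coprimeTo _
  coprime-^ q⊥n (suc s) = coprime-* q⊥n (coprime-^ q⊥n s)
    where
    coprime-* : ∀ {a b c} → Coprime a c → Coprime b c → Coprime (a * b) c
    coprime-* {a} a⊥c b⊥c (d∣ab , d∣c) =
      b⊥c (coprime-divisor (λ (x∣d , x∣a) → a⊥c (x∣a , ∣-trans x∣d d∣c)) d∣ab , d∣c)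

  coprime-∣⇒*∣ : ∀ {a b c} → Coprime a b → a ∣ c → b ∣ c → a * b ∣ c
  coprime-∣⇒*∣ {a} {b} a⊥b a∣c b∣c =
    subst (_∣ _) (trans (sym (*-identityˡ (lcm a b))) (trans (cong (_* lcm a b) (sym (coprime⇒gcd≡1 a⊥b))) (gcd*lcm a b)))
      (lcm-least a∣c b∣c)

  ∤⇒larger-prime-power : ∀ {a e} .{{_ : NonZero a}} .{{_ : NonZero e}} → ¬ a ∣ e →
    ∃[ q ] ∃[ s ] ∃[ a′ ] ∃[ r ] ∃[ e′ ] Prime q × a ≡ q ^ s * a′ × e ≡ q ^ r * e′ × ¬ q ∣ e′ × r < s
  ∤⇒larger-prime-power {a} {e} a∤e = excess (prime-divisor k 2≤k)
    where
    k = quotient (gcd[m,n]∣m a e)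
    a≡kG : a ≡ k * gcd a e
    a≡kG = _∣_.equality (gcd[m,n]∣m a e)
    2≤k : 2 ≤ k
    2≤k with k in k≡
    ... | 0 = contradiction (trans a≡kG (cong (_* gcd a e) k≡)) (ℕ.≢-nonZero⁻¹ a)
    ... | 1 = contradiction (subst (_∣ e) (sym (trans a≡kG (trans (cong (_* gcd a e) k≡) (+-identityʳ _)))) (gcd[m,n]∣n a e)) a∤e
    ... | suc (suc _) = s≤s (s≤s z≤n)
    excess : ∃[ q ] Prime q × q ∣ k →
      ∃[ q ] ∃[ s ] ∃[ a′ ] ∃[ r ] ∃[ e′ ] Prime q × a ≡ q ^ s * a′ × e ≡ q ^ r * e′ × ¬ q ∣ e′ × r < s
    excess (q , q-prime , q∣k) with factor-out 2≤q a | factor-out 2≤q e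
      where 2≤q = ℕ.nonTrivial⇒n>1 q {{prime⇒nonTrivial q-prime}}
    ... | s , a′ , a≡ , q∤a′ | r , e′ , e≡ , q∤e′ = q , s , a′ , r , e′ , q-prime , a≡ , e≡ , q∤e′ , r<s
      where
      instance _ = prime⇒nonZero q-prime
      r<s : r < s
      r<s with r <? s
      ... | yes r<s = r<s
      ... | no r≮s = contradiction (*-cancelˡ-∣ (q ^ s) (subst (_∣ q ^ s * a′) (*-comm q (q ^ s)) qˢ⁺¹∣a)) q∤a′
        where
        instance _ = m^n≢0 q s
        qˢ∣e : q ^ s ∣ e
        qˢ∣e = ∣-trans (divides (q ^ (r ∸ s)) (trans (cong (q ^_) (sym (m∸n+n≡m (≮⇒≥ r≮s)))) (^-distribˡ-+-* q (r ∸ s) s)))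
                       (subst (q ^ r ∣_) (sym e≡) (m∣m*n e′))
        qˢ⁺¹∣a : q * q ^ s ∣ q ^ s * a′
        qˢ⁺¹∣a = subst (q * q ^ s ∣_) (trans (sym a≡kG) a≡)
                   (*-pres-∣ q∣k (gcd-greatest (subst (q ^ s ∣_) (sym a≡) (m∣m*n a′)) qˢ∣e))

open NatArithmetic

module MonicPolynomial where

  open import Data.Nat as ℕ using (zero; suc)
  open import Data.Integer using (_+_; _-_; -_; _*_; _^_; 0ℤ; 1ℤ)
  open import Data.Vec using (Vec; []; _∷_; replicate)

  -- c₀ ∷ c₁ ∷ ⋯ ∷ c_{d−1} ∷ [] stands for the monic polynomial X^d + c_{d−1} X^{d−1} + ⋯ + c₀.
  eval : ∀ {d} → Vec ℤ d → ℤ → ℤ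
  eval []       x = 1ℤ
  eval (c ∷ cs) x = c + x * eval cs x

  divide-by-root : ∀ {d} → Vec ℤ (suc d) → ℤ → Vec ℤ d
  divide-by-root (c ∷ [])      r = []
  divide-by-root (c ∷ c′ ∷ cs) r = eval (c′ ∷ cs) r ∷ divide-by-root (c′ ∷ cs) r

  eval-divide-by-root : ∀ {d} (f : Vec ℤ (suc d)) r x → eval f x ≡ (x - r) * eval (divide-by-root f r) x + eval f r
  eval-divide-by-root (c ∷ []) r x = linear c x r
    where
    linear : ∀ c x r → c + x * 1ℤ ≡ (x - r) * 1ℤ + (c + r * 1ℤ)
    linear = solve-∀
  eval-divide-by-root (c ∷ c′ ∷ cs) r x =
    trans (cong (λ y → c + x * y) (eval-divide-by-root (c′ ∷ cs) r x))
          (horner c x r (eval (divide-by-root (c′ ∷ cs) r) x) (eval (c′ ∷ cs) r))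
    where
    horner : ∀ c x r h g → c + x * ((x - r) * h + g) ≡ (x - r) * (g + x * h) + (c + r * g)
    horner = solve-∀

  X^[1+_]-1 : ∀ d → Vec ℤ (suc d)
  X^[1+ d ]-1 = - 1ℤ ∷ replicate d 0ℤ

  eval-X^[1+_]-1 : ∀ d x → eval X^[1+ d ]-1 x ≡ x ^ suc d - 1ℤ
  eval-X^[1+ d ]-1 x = trans (cong (λ y → - 1ℤ + x * y) (eval-X^ d)) (ℤ.+-comm (- 1ℤ) (x ^ suc d))
    where
    eval-X^ : ∀ d → eval (replicate d 0ℤ) x ≡ x ^ d
    eval-X^ zero    = refl
    eval-X^ (suc d) = trans (ℤ.+-identityˡ _) (cong (x *_) (eval-X^ d))

open MonicPolynomial

module Order (m : ℤ) where

  open import Data.Nat as ℕ using (zero; suc; _<_; z≤n; s≤s; >-nonZero)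
  open import Data.Nat.DivMod using (_%_; _/_; m≡m%n+[m/n]*n; m%n<n)
  open import Data.Nat.Coprimality as Coprime using (Coprime; coprime-divisor)
  open import Data.Nat.Primality using (prime⇒nonZero; prime⇒nonTrivial)
  open import Data.Integer using (_*_; _^_; 1ℤ)

  record IsOrder (u : ℤ) (e : ℕ) : Set where
    field
      positive : 1 ≤ e
      ^≡1⇒∣    : ∀ {t} → u ^ t ≡ 1ℤ mod m → e ℕ.∣ t
      ∣⇒^≡1    : ∀ {t} → e ℕ.∣ t → u ^ t ≡ 1ℤ mod m
  open IsOrder public

  ^*-≡1 : ∀ {u e} → u ^ e ≡ 1ℤ mod m → ∀ s → u ^ (s ℕ.* e) ≡ 1ℤ mod m
  ^*-≡1 {u} {e} u^e≡1 s = begin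
    u ^ (s ℕ.* e) ≡⟨ cong (u ^_) (ℕ.*-comm s e) ⟩
    u ^ (e ℕ.* s) ≡⟨ ℤ.^-*-assoc u e s ⟨
    (u ^ e) ^ s   ≈⟨ ^-cong-mod u^e≡1 s ⟩
    1ℤ ^ s        ≡⟨ ℤ.^-zeroˡ s ⟩
    1ℤ            ∎
    where open ≡-mod-Reasoning m

  *≡1-cancelʳ : ∀ {x y} → x * y ≡ 1ℤ mod m → y ≡ 1ℤ mod m → x ≡ 1ℤ mod m
  *≡1-cancelʳ {x} {y} xy≡1 y≡1 = begin
    x       ≡⟨ ℤ.*-identityʳ x ⟨
    x * 1ℤ  ≈⟨ *-congˡ-mod x y≡1 ⟨
    x * y   ≈⟨ xy≡1 ⟩
    1ℤ      ∎
    where open ≡-mod-Reasoning m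

  isOrder-least : ∀ {u e} → 1 ≤ e → u ^ e ≡ 1ℤ mod m → (∀ {t} → 1 ≤ t → t < e → ¬ u ^ t ≡ 1ℤ mod m) → IsOrder u e
  isOrder-least {u} {e@(suc _)} 1≤e u^e≡1 below = record
    { positive = 1≤e
    ; ^≡1⇒∣    = divides-exponent
    ; ∣⇒^≡1    = λ { (ℕ.divides s refl) → ^*-≡1 u^e≡1 s }
    }
    where
    divides-exponent : ∀ {t} → u ^ t ≡ 1ℤ mod m → e ℕ.∣ t
    divides-exponent {t} u^t≡1 with t % e | m%n<n t e | m≡m%n+[m/n]*n t e
    ... | zero  | _   | t≡ = ℕ.divides (t / e) t≡
    ... | suc r | r<e | t≡ = ⊥-elim (below (s≤s z≤n) r<e (*≡1-cancelʳ u^r*rest≡1 (^*-≡1 u^e≡1 (t / e))))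
      where
      u^r*rest≡1 : u ^ suc r * u ^ (t / e ℕ.* e) ≡ 1ℤ mod m
      u^r*rest≡1 = subst (_≡ 1ℤ mod m) (trans (cong (u ^_) t≡) (ℤ.^-distribˡ-+-* u (suc r) _)) u^t≡1

  isOrder-unique : ∀ {u e e′} → IsOrder u e → IsOrder u e′ → e ≡ e′
  isOrder-unique o o′ = ℕ.∣-antisym (^≡1⇒∣ o (∣⇒^≡1 o′ ℕ.∣-refl)) (^≡1⇒∣ o′ (∣⇒^≡1 o ℕ.∣-refl))

  isOrder-resp : ∀ {u v e} → u ≡ v mod m → IsOrder u e → IsOrder v e
  isOrder-resp u≡v o = record
    { positive = positive o
    ; ^≡1⇒∣    = λ {t} v^t≡1 → ^≡1⇒∣ o (≡-mod-trans (^-cong-mod u≡v t) v^t≡1)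
    ; ∣⇒^≡1    = λ {t} e∣t → ≡-mod-trans (^-cong-mod (≡-mod-sym u≡v) t) (∣⇒^≡1 o e∣t)
    }

  isOrder-^ : ∀ {u c d} → 1 ≤ c → IsOrder u (c ℕ.* d) → IsOrder (u ^ c) d
  isOrder-^ {u} {c} {d} 1≤c o = record
    { positive = ℕ.>-nonZero⁻¹ d {{ℕ.m*n≢0⇒n≢0 c {{>-nonZero (positive o)}}}}
    ; ^≡1⇒∣    = λ {t} u^ct≡1 → ℕ.*-cancelˡ-∣ c {{>-nonZero 1≤c}} (^≡1⇒∣ o (subst (_≡ 1ℤ mod m) (ℤ.^-*-assoc u c t) u^ct≡1))
    ; ∣⇒^≡1    = λ {t} d∣t → subst (_≡ 1ℤ mod m) (sym (ℤ.^-*-assoc u c t)) (∣⇒^≡1 o (ℕ.*-monoʳ-∣ c d∣t))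
    }

  isOrder-* : ∀ {x y a b} → IsOrder x a → IsOrder y b → Coprime a b → IsOrder (x * y) (a ℕ.* b)
  isOrder-* {x} {y} {a} {b} ox oy a⊥b = record
    { positive = ℕ.*-mono-≤ (positive ox) (positive oy)
    ; ^≡1⇒∣    = λ {t} xy^t≡1 → coprime-∣⇒*∣ a⊥b (a∣t xy^t≡1) (b∣t xy^t≡1)
    ; ∣⇒^≡1    = λ {t} ab∣t → begin
        (x * y) ^ t     ≡⟨ ^-distribʳ-* x y t ⟩
        x ^ t * y ^ t   ≈⟨ *-cong-mod (∣⇒^≡1 ox (ℕ.∣-trans (ℕ.m∣m*n b) ab∣t)) (∣⇒^≡1 oy (ℕ.∣-trans (ℕ.n∣m*n a) ab∣t)) ⟩
        1ℤ * 1ℤ         ∎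
    }
    where
    open ≡-mod-Reasoning m
    split : ∀ {t} s → (x * y) ^ t ≡ 1ℤ mod m → x ^ (s ℕ.* t) * y ^ (s ℕ.* t) ≡ 1ℤ mod m
    split {t} s xy^t≡1 = subst (_≡ 1ℤ mod m) (^-distribʳ-* x y (s ℕ.* t)) (^*-≡1 xy^t≡1 s)
    a∣t : ∀ {t} → (x * y) ^ t ≡ 1ℤ mod m → a ℕ.∣ t
    a∣t {t} xy^t≡1 = coprime-divisor a⊥b (^≡1⇒∣ ox (*≡1-cancelʳ (split b xy^t≡1) (∣⇒^≡1 oy (ℕ.m∣m*n t))))
    b∣t : ∀ {t} → (x * y) ^ t ≡ 1ℤ mod m → b ℕ.∣ t
    b∣t {t} xy^t≡1 = coprime-divisor (Coprime.sym a⊥b)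
      (^≡1⇒∣ oy (*≡1-cancelʳ (subst (_≡ 1ℤ mod m) (ℤ.*-comm (x ^ (a ℕ.* t)) _) (split a xy^t≡1)) (∣⇒^≡1 ox (ℕ.m∣m*n t))))

  larger-order : ∀ {u g a e} → IsOrder u a → IsOrder g e → ¬ a ℕ.∣ e → ∃[ w ] ∃[ M ] IsOrder w M × e < M
  larger-order {u} {g} {a} {e} ou og a∤e
    with ∤⇒larger-prime-power {{>-nonZero (positive ou)}} {{>-nonZero (positive og)}} a∤e
  ... | q , s , a′ , r , e′ , q-prime , refl , refl , q∤e′ , r<s =
    u ^ a′ * g ^ (q ℕ.^ r) , q ℕ.^ s ℕ.* e′ , isOrder-* ou′ og′ qˢ⊥e′ , e<M
    where
    instance
      _ = prime⇒nonZero q-prime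
      _ = ℕ.m*n≢0⇒n≢0 (q ℕ.^ s) {{>-nonZero (positive ou)}}
      _ = ℕ.m*n≢0⇒n≢0 (q ℕ.^ r) {{>-nonZero (positive og)}}
    qˢ⊥e′ : Coprime (q ℕ.^ s) e′
    qˢ⊥e′ = coprime-^ (prime∤⇒coprime q-prime q∤e′) s
    ou′ : IsOrder (u ^ a′) (q ℕ.^ s)
    ou′ = isOrder-^ (ℕ.>-nonZero⁻¹ a′) (subst (IsOrder u) (ℕ.*-comm (q ℕ.^ s) a′) ou)
    og′ : IsOrder (g ^ (q ℕ.^ r)) e′
    og′ = isOrder-^ (ℕ.>-nonZero⁻¹ (q ℕ.^ r) {{ℕ.m^n≢0 q r}}) og
    e<M : q ℕ.^ r ℕ.* e′ < q ℕ.^ s ℕ.* e′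
    e<M = ℕ.*-monoˡ-< e′ (ℕ.^-monoʳ-< q (ℕ.nonTrivial⇒n>1 q {{prime⇒nonTrivial q-prime}}) r<s)

module ModPrime (p : ℕ) (p-prime : Prime p) where

  open import Data.Nat as ℕ using (zero; suc; _<_; _∸_; z≤n; s≤s; NonZero; >-nonZero)
  open import Data.Nat.Primality using (prime⇒nonZero; prime⇒nonTrivial; euclidsLemma)
  open import Data.Integer using (_+_; _-_; -_; _*_; _^_; 0ℤ; 1ℤ; _%ℕ_) renaming (∣_∣ to abs)
  open import Data.Integer.DivMod using (n%ℕd<d)
  open import Data.Integer.Divisibility.Signed
  open import Data.Fin as Fin using (Fin; toℕ; fromℕ<)
  import Data.Fin.Properties as Fin
  open import Data.Vec using (Vec; []; _∷_)
  open import Data.List using (List; []; _∷_; length; applyUpTo)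
  open import Data.List.Properties using (length-applyUpTo)
  open import Data.List.Relation.Unary.All as All using (All; _∷_)
  open import Data.List.Relation.Unary.All.Properties using (¬Any⇒All¬; applyUpTo⁺₁)
  open import Data.List.Relation.Unary.Any using (Any; any?)
  open import Data.List.Relation.Unary.Any.Properties using (applyUpTo⁻)
  open import Data.List.Relation.Unary.AllPairs as AllPairs using (AllPairs; _∷_)
  open import Data.List.Relation.Unary.AllPairs.Properties as AllPairs using ()
  open import Data.List.Membership.Propositional using (_∈_)
  open import Data.List.Membership.Propositional.Properties using (∈-applyUpTo⁺)
  open import Data.List.Extrema.Nat using (argmax; argmax-all; f[xs]≤f[argmax])

  instance
    p≢0 : NonZero p
    p≢0 = prime⇒nonZero p-prime

  2≤p : 2 ≤ p
  2≤p = ℕ.nonTrivial⇒n>1 p {{prime⇒nonTrivial p-prime}}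

  p-1<p : p ∸ 1 < p
  p-1<p = ℕ.∸-monoʳ-< (s≤s z≤n) (ℕ.<-trans (s≤s z≤n) 2≤p)

  open Order (+ p) public

  Unit : ℤ → Set
  Unit x = ¬ + p ∣ x

  euclid : ∀ x y → + p ∣ x * y → + p ∣ x ⊎ + p ∣ y
  euclid x y p∣xy with euclidsLemma (abs x) (abs y) p-prime (subst (p ℕ.∣_) (ℤ.abs-* x y) (∣⇒∣ᵤ p∣xy))
  ... | inj₁ p∣x = inj₁ (∣ᵤ⇒∣ p∣x)
  ... | inj₂ p∣y = inj₂ (∣ᵤ⇒∣ p∣y)

  *-unit : ∀ {x y} → Unit x → Unit y → Unit (x * y)
  *-unit {x} {y} ux uy p∣xy = [ ux , uy ]′ (euclid x y p∣xy)

  small-unit : ∀ {x} → 0 < x → x < p → Unit (+ x)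
  small-unit 0<x x<p p∣x = ℕ.<⇒≱ x<p (ℕ.∣⇒≤ {{>-nonZero 0<x}} (∣⇒∣ᵤ p∣x))

  1-unit : Unit 1ℤ
  1-unit = small-unit (s≤s z≤n) 2≤p

  1≢0 : ¬ 1ℤ ≡ 0ℤ mod + p
  1≢0 = 1-unit ∘ ≡0-mod⇒∣

  ^-unit : ∀ {x} → Unit x → ∀ t → Unit (x ^ t)
  ^-unit ux zero    = 1-unit
  ^-unit ux (suc t) = *-unit ux (^-unit ux t)

  unit-resp : ∀ {x y} → x ≡ y mod + p → Unit x → Unit y
  unit-resp {x} {y} (congruent p∣x-y) ux p∣y = ux (subst (+ p ∣_) (cancel x y) (∣m∣n⇒∣m+n p∣x-y p∣y))
    where
    cancel : ∀ x y → x - y + y ≡ x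
    cancel = solve-∀

  *-cancelˡ-mod : ∀ {a x y} → Unit a → a * x ≡ a * y mod + p → x ≡ y mod + p
  *-cancelˡ-mod {a} {x} {y} ua (congruent p∣ax-ay) = [ (λ p∣a → contradiction p∣a ua) , congruent ]′
    (euclid a (x - y) (subst (+ p ∣_) (factor a x y) p∣ax-ay))
    where
    factor : ∀ a x y → a * x - a * y ≡ a * (x - y)
    factor = solve-∀

  ^-≡⇒^∸≡1 : ∀ {w i j} → Unit w → i ≤ j → w ^ i ≡ w ^ j mod + p → w ^ (j ∸ i) ≡ 1ℤ mod + p
  ^-≡⇒^∸≡1 {w} {i} {j} uw i≤j w^i≡w^j = *-cancelˡ-mod (^-unit uw i) (begin
    w ^ i * w ^ (j ∸ i)   ≡⟨ ℤ.^-distribˡ-+-* w i (j ∸ i) ⟨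
    w ^ (i ℕ.+ (j ∸ i))   ≡⟨ cong (w ^_) (ℕ.m+[n∸m]≡n i≤j) ⟩
    w ^ j                 ≈⟨ w^i≡w^j ⟨
    w ^ i                 ≡⟨ ℤ.*-identityʳ (w ^ i) ⟨
    w ^ i * 1ℤ            ∎)
    where open ≡-mod-Reasoning (+ p)

  isOrder⇒unit : ∀ {u e} → IsOrder u e → Unit u
  isOrder⇒unit {u} {suc e} ou p∣u = 1≢0 (begin
    1ℤ           ≈⟨ ∣⇒^≡1 ou ℕ.∣-refl ⟨
    u * u ^ e    ≈⟨ *-congʳ-mod (u ^ e) (∣⇒≡0-mod p∣u) ⟩
    0ℤ * u ^ e   ≡⟨ ℤ.*-zeroˡ (u ^ e) ⟩
    0ℤ           ∎)
    where open ≡-mod-Reasoning (+ p)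

  Distinct : List ℤ → Set
  Distinct = AllPairs (λ r s → ¬ r ≡ s mod + p)

  IsRoot : ∀ {d} → Vec ℤ d → ℤ → Set
  IsRoot f r = eval f r ≡ 0ℤ mod + p

  roots≤degree : ∀ {d} (f : Vec ℤ d) {rs} → Distinct rs → All (IsRoot f) rs → length rs ≤ d
  roots≤degree f         {[]}     _ _ = z≤n
  roots≤degree []        {r ∷ rs} _ (1≡0 ∷ _) = contradiction 1≡0 1≢0
  roots≤degree f@(_ ∷ _) {r ∷ rs} (r≢rs ∷ distinct) (root-r ∷ roots) =
    s≤s (roots≤degree (divide-by-root f r) distinct (All.zipWith root-of-quotient (r≢rs , roots)))
    where
    root-of-quotient : ∀ {s} → (¬ r ≡ s mod + p) × IsRoot f s → IsRoot (divide-by-root f r) s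
    root-of-quotient {s} (r≢s , root-s) = *-cancelˡ-mod (r≢s ∘ ≡-mod-sym ∘ congruent) (begin
      (s - r) * q               ≡⟨ ℤ.+-identityʳ _ ⟨
      (s - r) * q + 0ℤ          ≈⟨ +-congˡ-mod ((s - r) * q) root-r ⟨
      (s - r) * q + eval f r    ≡⟨ eval-divide-by-root f r s ⟨
      eval f s                  ≈⟨ root-s ⟩
      0ℤ                        ≡⟨ ℤ.*-zeroʳ (s - r) ⟨
      (s - r) * 0ℤ              ∎)
      where
      open ≡-mod-Reasoning (+ p)
      q = eval (divide-by-root f r) s

  unit⇒positive : ∀ {x} → Unit (+ x) → 0 < x
  unit⇒positive {zero}  ux = contradiction (divides 0ℤ refl) ux
  unit⇒positive {suc _} _  = s≤s z≤n

  period : ∀ {w} → Unit w → ∃[ d ] 0 < d × d ≤ p ∸ 1 × w ^ d ≡ 1ℤ mod + p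
  period {w} uw = collision (Fin.pigeonhole p-1<p residue-1)
    where
    residue : ℕ → ℕ
    residue i = (w ^ i) %ℕ p
    residue-positive : ∀ i → 0 < residue i
    residue-positive i = unit⇒positive (unit-resp (%ℕ-≡-mod p (w ^ i)) (^-unit uw i))
    residue-1 : Fin p → Fin (p ∸ 1)
    residue-1 i = fromℕ< (ℕ.∸-monoˡ-< (n%ℕd<d (w ^ toℕ i) p) (residue-positive (toℕ i)))
    collision : (∃₂ λ i j → i Fin.< j × residue-1 i ≡ residue-1 j) → ∃[ d ] 0 < d × d ≤ p ∸ 1 × w ^ d ≡ 1ℤ mod + p
    collision (i , j , i<j , same-residue) = toℕ j ∸ toℕ i , ℕ.m<n⇒0<n∸m i<j , d≤ , w^d≡1
      where
      open ≡-mod-Reasoning (+ p)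
      d≤ : toℕ j ∸ toℕ i ≤ p ∸ 1
      d≤ = ℕ.≤-trans (ℕ.m∸n≤m (toℕ j) (toℕ i)) (ℕ.∸-monoˡ-≤ 1 (Fin.toℕ<n j))
      residue-1-≡ : residue (toℕ i) ∸ 1 ≡ residue (toℕ j) ∸ 1
      residue-1-≡ = trans (sym (Fin.toℕ-fromℕ< _)) (trans (cong toℕ same-residue) (Fin.toℕ-fromℕ< _))
      w^i≡w^j : w ^ toℕ i ≡ w ^ toℕ j mod + p
      w^i≡w^j = begin
        w ^ toℕ i           ≈⟨ %ℕ-≡-mod p (w ^ toℕ i) ⟩
        + residue (toℕ i)   ≡⟨ cong +_ (ℕ.∸-cancelʳ-≡ (residue-positive (toℕ i)) (residue-positive (toℕ j)) residue-1-≡) ⟩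
        + residue (toℕ j)   ≈⟨ %ℕ-≡-mod p (w ^ toℕ j) ⟨
        w ^ toℕ j           ∎
      w^d≡1 : w ^ (toℕ j ∸ toℕ i) ≡ 1ℤ mod + p
      w^d≡1 = ^-≡⇒^∸≡1 uw (ℕ.<⇒≤ i<j) w^i≡w^j

  ^≡1? : ∀ u t → Dec (u ^ t ≡ 1ℤ mod + p)
  ^≡1? u t = ≡-mod? (u ^ t) 1ℤ

  order-of : ℤ → ℕ
  order-of u = suc (first (^≡1? u ∘ suc) (p ∸ 1))

  order-of-isOrder : ∀ {u} → Unit u → IsOrder u (order-of u) × order-of u < p
  order-of-isOrder {u} uu = smallest (period uu)
    where
    below : ∀ {t} → 1 ≤ t → t < order-of u → ¬ u ^ t ≡ 1ℤ mod + p
    below {suc t} _ (s≤s t<first) = first-minimal (^≡1? u ∘ suc) (p ∸ 1) t<first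
    smallest : ∃[ d ] 0 < d × d ≤ p ∸ 1 × u ^ d ≡ 1ℤ mod + p → IsOrder u (order-of u) × order-of u < p
    smallest (suc i , _ , i<p-1 , u^d≡1) with first-satisfies (^≡1? u ∘ suc) (p ∸ 1) i<p-1 u^d≡1
    ... | found , first≤i = isOrder-least (s≤s z≤n) found below , ℕ.≤-<-trans (s≤s first≤i) (ℕ.≤-<-trans i<p-1 p-1<p)

  residues : List ℤ
  residues = applyUpTo (+_ ∘ suc) (p ∸ 1)

  ∈-residues : ∀ {x} → 0 < x → x < p → + x ∈ residues
  ∈-residues {suc x} _ x<p = ∈-applyUpTo⁺ (+_ ∘ suc) (ℕ.∸-monoˡ-< x<p (s≤s z≤n))

  -- An element of maximal order e. Every order divides e (by larger-order), so every unit is a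
  -- root of X^e − 1, and roots≤degree then forces the e powers of g to reach every unit.
  g : ℤ
  g = argmax order-of 1ℤ residues

  e : ℕ
  e = order-of g

  g-unit : Unit g
  g-unit = argmax-all order-of {P = Unit} 1-unit
    (applyUpTo⁺₁ (+_ ∘ suc) (p ∸ 1) (λ i<p-1 → small-unit (s≤s z≤n) (ℕ.≤-<-trans i<p-1 p-1<p)))

  isOrder-g : IsOrder g e
  isOrder-g = proj₁ (order-of-isOrder g-unit)

  e<p : e < p
  e<p = proj₂ (order-of-isOrder g-unit)

  order≤e : ∀ {u m} → IsOrder u m → m ≤ e
  order≤e {u} {m} ou = subst (_≤ e) order-of-r≡m (All.lookup (f[xs]≤f[argmax] {f = order-of} 1ℤ residues) (∈-residues 0<r (n%ℕd<d u p)))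
    where
    r = u %ℕ p
    u≡r : u ≡ + r mod + p
    u≡r = %ℕ-≡-mod p u
    r-unit : Unit (+ r)
    r-unit = unit-resp u≡r (isOrder⇒unit ou)
    0<r : 0 < r
    0<r = unit⇒positive r-unit
    order-of-r≡m : order-of (+ r) ≡ m
    order-of-r≡m = isOrder-unique (proj₁ (order-of-isOrder r-unit)) (isOrder-resp u≡r ou)

  ^e≡1 : ∀ {u} → Unit u → u ^ e ≡ 1ℤ mod + p
  ^e≡1 {u} uu = ∣⇒^≡1 ou (decidable-stable (order-of u ℕ.∣? e) order∣e)
    where
    ou : IsOrder u (order-of u)
    ou = proj₁ (order-of-isOrder uu)
    order∣e : ¬ ¬ order-of u ℕ.∣ e
    order∣e m∤e = let _ , _ , ow , e<M = larger-order ou isOrder-g m∤e in ℕ.<⇒≱ e<M (order≤e ow)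

  powers : List ℤ
  powers = applyUpTo (g ^_) e

  powers-distinct : Distinct powers
  powers-distinct = AllPairs.applyUpTo⁺₁ (g ^_) e distinct
    where
    distinct : ∀ {i j} → i < j → j < e → ¬ g ^ i ≡ g ^ j mod + p
    distinct {i} {j} i<j j<e g^i≡g^j = ℕ.<⇒≱ (ℕ.≤-<-trans (ℕ.m∸n≤m j i) j<e)
      (ℕ.∣⇒≤ {{ℕ.>-nonZero (ℕ.m<n⇒0<n∸m i<j)}} (^≡1⇒∣ isOrder-g (^-≡⇒^∸≡1 g-unit (ℕ.<⇒≤ i<j) g^i≡g^j)))

  root-of-unity : ∀ {w} → Unit w → IsRoot X^[1+ ℕ.pred e ]-1 w
  root-of-unity {w} uw = begin
    eval X^[1+ ℕ.pred e ]-1 w   ≡⟨ eval-X^[1+ ℕ.pred e ]-1 w ⟩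
    w ^ e - 1ℤ                  ≈⟨ +-congʳ-mod (- 1ℤ) (^e≡1 uw) ⟩
    1ℤ - 1ℤ                     ∎
    where open ≡-mod-Reasoning (+ p)

  generator : ∀ {u} → Unit u → ∃[ t ] g ^ t * u ≡ 1ℤ mod + p
  generator {u} uu = search (any? (≡-mod? {+ p} v) powers)
    where
    v = u ^ ℕ.pred e
    search : Dec (Any (v ≡_mod + p) powers) → ∃[ t ] g ^ t * u ≡ 1ℤ mod + p
    search (yes hit) = let t , _ , v≡g^t = applyUpTo⁻ (g ^_) hit in t , (begin
      g ^ t * u   ≈⟨ *-congʳ-mod u v≡g^t ⟨
      v * u       ≡⟨ ℤ.*-comm v u ⟩
      u ^ e       ≈⟨ ^e≡1 uu ⟩
      1ℤ          ∎)
      where open ≡-mod-Reasoning (+ p)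
    search (no miss) = contradiction
      (roots≤degree X^[1+ ℕ.pred e ]-1 (¬Any⇒All¬ powers miss ∷ powers-distinct)
                    (root-of-unity (^-unit uu (ℕ.pred e)) ∷ applyUpTo⁺₁ (g ^_) e (λ {i} _ → root-of-unity (^-unit g-unit i))))
      (subst (λ l → ¬ suc l ≤ e) (sym (length-applyUpTo (g ^_) e)) (ℕ.<-irrefl refl))

module Parity where

  open import Data.Nat as ℕ using (suc; s≤s)
  open import Data.Nat.Primality using (prime[2])
  open import Data.Integer using (_*_; 1ℤ; _%ℕ_)
  open import Data.Integer.DivMod using (n%ℕd<d)
  open import Data.Integer.Divisibility.Signed

  open ModPrime 2 prime[2] public using () renaming (Unit to Odd; *-unit to *-odd; ^-unit to ^-odd; euclid to euclid₂)

  odd⇒≡1-mod-2 : ∀ {x} → Odd x → x ≡ 1ℤ mod + 2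
  odd⇒≡1-mod-2 {x} x-odd with x %ℕ 2 | %ℕ-≡-mod 2 x | n%ℕd<d x 2
  ... | 0           | x≡0 | _               = contradiction (≡0-mod⇒∣ x≡0) x-odd
  ... | 1           | x≡1 | _               = x≡1
  ... | suc (suc _) | _   | s≤s (s≤s ())

  ≡-mod-2*odd : ∀ {q x y} → Odd q → x ≡ y mod + 2 → x ≡ y mod q → x ≡ y mod + 2 * q
  ≡-mod-2*odd {q} q-odd (congruent 2∣x-y) (congruent (divides c x-y≡cq)) with euclid₂ c q (subst (+ 2 ∣_) x-y≡cq 2∣x-y)
  ... | inj₁ (divides c′ c≡c′2) = congruent (divides c′ (trans x-y≡cq (trans (cong (_* q) c≡c′2) (ℤ.*-assoc c′ (+ 2) q))))
  ... | inj₂ 2∣q               = contradiction 2∣q q-odd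

open Parity

module Binomial where

  open import Data.Nat as ℕ using (zero; suc; _∸_)
  open import Data.Integer using (_+_; _-_; _*_; _^_; 0ℤ; 1ℤ)
  open import Data.Integer.Divisibility.Signed

  binomial-linear : ∀ y x s → (y + x) ^ s ≡ y ^ s + + s * y ^ (s ∸ 1) * x mod (x * x)
  binomial-linear y x zero = ≡-mod-reflexive (sym (ℤ.+-identityʳ 1ℤ))
  binomial-linear y x (suc s) = begin
    (y + x) * (y + x) ^ s                                     ≈⟨ *-congˡ-mod (y + x) (binomial-linear y x s) ⟩
    (y + x) * (y ^ s + + s * y ^ (s ∸ 1) * x)                 ≡⟨ expand y x (y ^ s) (+ s * y ^ (s ∸ 1)) ⟩
    y * y ^ s + (y ^ s + y * (+ s * y ^ (s ∸ 1))) * x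
      + + s * y ^ (s ∸ 1) * (x * x)                           ≈⟨ +-multiple-mod _ (+ s * y ^ (s ∸ 1)) ⟩
    y * y ^ s + (y ^ s + y * (+ s * y ^ (s ∸ 1))) * x         ≡⟨ cong (λ z → y * y ^ s + (y ^ s + z) * x) (shift s) ⟩
    y * y ^ s + (y ^ s + + s * y ^ s) * x                     ≡⟨ collect (y ^ s) (+ s) (y * y ^ s) x ⟩
    y * y ^ s + + suc s * y ^ s * x                           ∎
    where
    open ≡-mod-Reasoning (x * x)
    expand : ∀ y x Y S → (y + x) * (Y + S * x) ≡ y * Y + (Y + y * S) * x + S * (x * x)
    expand = solve-∀
    collect : ∀ Y c Z x → Z + (Y + c * Y) * x ≡ Z + (1ℤ + c) * Y * x
    collect = solve-∀
    shift : ∀ s → y * (+ s * y ^ (s ∸ 1)) ≡ + s * y ^ s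
    shift zero    = ℤ.*-zeroʳ y
    shift (suc s) = trans (sym (ℤ.*-assoc y (+ suc s) (y ^ s))) (trans (cong (_* y ^ s) (ℤ.*-comm y (+ suc s))) (ℤ.*-assoc (+ suc s) y (y ^ s)))

  triangle : ℕ → ℤ
  triangle zero    = 0ℤ
  triangle (suc s) = triangle s + + s

  triangle-double : ∀ s → triangle s + triangle s ≡ + s * (+ s - 1ℤ)
  triangle-double zero    = refl
  triangle-double (suc s) = begin
    (triangle s + + s) + (triangle s + + s)   ≡⟨ regroup (triangle s) (+ s) ⟩
    (triangle s + triangle s) + (+ s + + s)   ≡⟨ cong (_+ (+ s + + s)) (triangle-double s) ⟩
    + s * (+ s - 1ℤ) + (+ s + + s)            ≡⟨ step (+ s) ⟩
    (1ℤ + + s) * ((1ℤ + + s) - 1ℤ)            ∎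
    where
    open ≡-Reasoning
    regroup : ∀ t c → (t + c) + (t + c) ≡ (t + t) + (c + c)
    regroup = solve-∀
    step : ∀ c → c * (c - 1ℤ) + (c + c) ≡ (1ℤ + c) * ((1ℤ + c) - 1ℤ)
    step = solve-∀

  binomial-quadratic : ∀ x s → (1ℤ + x) ^ s ≡ 1ℤ + + s * x + triangle s * (x * x) mod (x * x * x)
  binomial-quadratic x zero = ≡-mod-reflexive (constant x)
    where
    constant : ∀ x → 1ℤ ≡ 1ℤ + 0ℤ * x + 0ℤ * (x * x)
    constant = solve-∀
  binomial-quadratic x (suc s) = begin
    (1ℤ + x) * (1ℤ + x) ^ s                                   ≈⟨ *-congˡ-mod (1ℤ + x) (binomial-quadratic x s) ⟩
    (1ℤ + x) * (1ℤ + + s * x + triangle s * (x * x))          ≡⟨ expand x (+ s) (triangle s) ⟩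
    1ℤ + (1ℤ + + s) * x + (triangle s + + s) * (x * x) + triangle s * (x * x * x)
                                                              ≈⟨ +-multiple-mod _ (triangle s) ⟩
    1ℤ + (1ℤ + + s) * x + (triangle s + + s) * (x * x)        ∎
    where
    open ≡-mod-Reasoning (x * x * x)
    expand : ∀ x c t → (1ℤ + x) * (1ℤ + c * x + t * (x * x)) ≡ 1ℤ + (1ℤ + c) * x + (t + c) * (x * x) + t * (x * x * x)
    expand = solve-∀

  *∣*-square : ∀ {d M} → d ∣ M → M * d ∣ M * M
  *∣*-square {d} {M} (divides k M≡kd) = divides k (trans (cong (M *_) M≡kd) (rotate M k d))
    where
    rotate : ∀ M k d → M * (k * d) ≡ k * (M * d)
    rotate = solve-∀

  binomial-correction : ∀ {d M} w c s → d ∣ M → (1ℤ + M * w) ^ s * (1ℤ + M * c) ≡ 1ℤ + M * (+ s * w + c) mod (M * d)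
  binomial-correction {d} {M} w c s d∣M = begin
    (1ℤ + M * w) ^ s * (1ℤ + M * c)                             ≈⟨ *-congʳ-mod (1ℤ + M * c) linear ⟩
    (1ℤ ^ s + + s * 1ℤ ^ (s ∸ 1) * (M * w)) * (1ℤ + M * c)     ≡⟨ cong₂ (λ a b → (a + + s * b * (M * w)) * (1ℤ + M * c))
                                                                         (ℤ.^-zeroˡ s) (ℤ.^-zeroˡ (s ∸ 1)) ⟩
    (1ℤ + + s * 1ℤ * (M * w)) * (1ℤ + M * c)                   ≡⟨ expand (+ s) M w c ⟩
    1ℤ + M * (+ s * w + c) + + s * w * c * (M * M)              ≈⟨ +-∣ʳ-mod _ (∣n⇒∣m*n (+ s * w * c) (*∣*-square d∣M)) ⟩
    1ℤ + M * (+ s * w + c)                                      ∎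
    where
    open ≡-mod-Reasoning (M * d)
    square : ∀ M w → (M * w) * (M * w) ≡ w * w * (M * M)
    square = solve-∀
    linear : (1ℤ + M * w) ^ s ≡ 1ℤ ^ s + + s * 1ℤ ^ (s ∸ 1) * (M * w) mod (M * d)
    linear = ≡-mod-∣ (subst (M * d ∣_) (sym (square M w)) (∣n⇒∣m*n (w * w) (*∣*-square d∣M))) (binomial-linear 1ℤ (M * w) s)
    expand : ∀ s M w c → (1ℤ + s * 1ℤ * (M * w)) * (1ℤ + M * c) ≡ 1ℤ + M * (s * w + c) + s * w * c * (M * M)
    expand = solve-∀

open Binomial

module Lifting (p : ℕ) (p-prime : Prime p) (p-odd : ¬ 2 ℕ.∣ p) where

  open import Data.Nat as ℕ using (zero; suc; _<_; _∸_; z≤n; s≤s)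
  open import Data.Integer using (_+_; _-_; -_; _*_; _^_; 0ℤ; 1ℤ; _%ℕ_)
  open import Data.Integer.Divisibility.Signed

  open ModPrime p p-prime

  P : ℤ
  P = + p

  2<p : 2 < p
  2<p with ℕ.m≤n⇒m<n∨m≡n 2≤p
  ... | inj₁ 2<p = 2<p
  ... | inj₂ refl = contradiction ℕ.∣-refl p-odd

  P∣triangle : P ∣ triangle p
  P∣triangle with euclid (+ 2) (triangle p) (divides (P - 1ℤ) (trans (double (triangle p)) (trans (triangle-double p) (ℤ.*-comm P _))))
    where
    double : ∀ t → + 2 * t ≡ t + t
    double = solve-∀
  ... | inj₁ P∣2 = contradiction P∣2 (small-unit (s≤s z≤n) 2<p)
  ... | inj₂ P∣T = P∣T

  -- Raising to the p-th power gains exactly one factor of p; this uses p ∣ C(p, 2), i.e. p odd.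
  ^p-lift : ∀ j {X w} → X ≡ 1ℤ + P ^ suc j * w mod P ^ suc (suc j) → X ^ p ≡ 1ℤ + P ^ suc (suc j) * w mod P ^ suc (suc (suc j))
  ^p-lift j {X} {w} X≡ = begin
    X ^ p                                         ≡⟨ cong (_^ p) X≡1+x ⟩
    (1ℤ + x) ^ p                                  ≈⟨ ≡-mod-∣ (divides (Q * Q * w′ * w′ * w′) (cube P Q w′)) (binomial-quadratic x p) ⟩
    1ℤ + P * x + triangle p * (x * x)             ≡⟨ cong (λ T → 1ℤ + P * x + T * (x * x)) (_∣_.equality P∣triangle) ⟩
    1ℤ + P * x + h * P * (x * x)                  ≡⟨ regroup P Q w z h ⟩
    1ℤ + P * (P * Q) * w + (z + h * Q * w′ * w′) * (P * (P * (P * Q)))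
                                                  ≈⟨ +-multiple-mod _ (z + h * Q * w′ * w′) ⟩
    1ℤ + P * (P * Q) * w                          ∎
    where
    open ≡-mod-Reasoning (P ^ suc (suc (suc j)))
    Q = P ^ j
    z = quotient (difference X≡)
    h = quotient P∣triangle
    w′ = w + P * z
    x = P * Q * w′
    X≡1+x : X ≡ 1ℤ + x
    X≡1+x = trans (≡-mod⇒≡+multiple X≡) (absorb P Q w z)
      where
      absorb : ∀ P Q w z → 1ℤ + P * Q * w + z * (P * (P * Q)) ≡ 1ℤ + P * Q * (w + P * z)
      absorb = solve-∀
    cube : ∀ P Q w′ → P * Q * w′ * (P * Q * w′) * (P * Q * w′) ≡ Q * Q * w′ * w′ * w′ * (P * (P * (P * Q)))
    cube = solve-∀
    regroup : ∀ P Q w z h → 1ℤ + P * (P * Q * (w + P * z)) + h * P * ((P * Q * (w + P * z)) * (P * Q * (w + P * z)))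
              ≡ 1ℤ + P * (P * Q) * w + (z + h * Q * (w + P * z) * (w + P * z)) * (P * (P * (P * Q)))
    regroup = solve-∀

  record LiftableRoot : Set where
    field
      a       : ℤ
      w₀      : ℤ
      a≡g     : a ≡ g mod P
      a^e≡    : a ^ e ≡ 1ℤ + P * w₀ mod P * P
      w₀-unit : Unit w₀

  liftable-root : LiftableRoot
  liftable-root = choose (P ∣? c)
    where
    c = quotient (difference (^e≡1 g-unit))
    g^e≡ : g ^ e ≡ 1ℤ + c * P
    g^e≡ = ≡-mod⇒≡+multiple (^e≡1 g-unit)
    w₁ = c + + e * g ^ (e ∸ 1)
    choose : Dec (P ∣ c) → LiftableRoot
    choose (no P∤c) = record
      { a = g ; w₀ = c ; a≡g = ≡-mod-refl ; w₀-unit = P∤c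
      ; a^e≡ = ≡-mod-reflexive (trans g^e≡ (cong (_+_ 1ℤ) (ℤ.*-comm c P)))
      }
    choose (yes P∣c) = record
      { a = g + P ; w₀ = w₁ ; a≡g = +-∣ʳ-mod g ∣-refl ; w₀-unit = w₁-unit
      ; a^e≡ = begin
          (g + P) ^ e                           ≈⟨ binomial-linear g P e ⟩
          g ^ e + + e * g ^ (e ∸ 1) * P         ≡⟨ cong (_+ + e * g ^ (e ∸ 1) * P) g^e≡ ⟩
          1ℤ + c * P + + e * g ^ (e ∸ 1) * P    ≡⟨ collect c (+ e * g ^ (e ∸ 1)) P ⟩
          1ℤ + P * w₁                           ∎
      }
      where
      open ≡-mod-Reasoning (P * P)
      collect : ∀ c k P → 1ℤ + c * P + k * P ≡ 1ℤ + P * (c + k)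
      collect = solve-∀
      w₁-unit : Unit w₁
      w₁-unit P∣w₁ = [ small-unit (positive isOrder-g) e<p , ^-unit g-unit (e ∸ 1) ]′
        (euclid (+ e) (g ^ (e ∸ 1)) (subst (P ∣_) (cancel c _) (∣m∣n⇒∣m-n P∣w₁ P∣c)))
        where
        cancel : ∀ c k → c + k - c ≡ k
        cancel = solve-∀

  open LiftableRoot liftable-root

  a^e^pʲ≡ : ∀ j → (a ^ e) ^ (p ℕ.^ j) ≡ 1ℤ + P ^ suc j * w₀ mod P ^ suc (suc j)
  a^e^pʲ≡ zero = begin
    (a ^ e) ^ 1             ≡⟨ ℤ.*-identityʳ (a ^ e) ⟩
    a ^ e                   ≈⟨ ≡-mod-∣ (∣-reflexive (cong (P *_) (ℤ.*-identityʳ P))) a^e≡ ⟩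
    1ℤ + P * w₀             ≡⟨ cong (λ Q → 1ℤ + Q * w₀) (ℤ.*-identityʳ P) ⟨
    1ℤ + P ^ 1 * w₀         ∎
    where open ≡-mod-Reasoning (P ^ 2)
  a^e^pʲ≡ (suc j) = subst (_≡ 1ℤ + P ^ suc (suc j) * w₀ mod P ^ suc (suc (suc j)))
    (trans (ℤ.^-*-assoc (a ^ e) (p ℕ.^ j) p) (cong ((a ^ e) ^_) (ℕ.*-comm (p ℕ.^ j) p)))
    (^p-lift j (a^e^pʲ≡ j))

  -- Lifting from p^(j+1) to p^(j+2) multiplies a^t·u ≡ 1 + p^(j+1)·c by a power
  -- (a^e)^(p^j·s) ≡ 1 + s·p^(j+1)·w₀; s = correction c cancels the error term modulo p^(j+2).
  correction : ℤ → ℕ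
  correction c = (- c * w₀ ^ (e ∸ 1)) %ℕ p

  P∣correction : ∀ c → P ∣ + correction c * w₀ + c
  P∣correction c = ≡0-mod⇒∣ (begin
    + correction c * w₀ + c          ≈⟨ +-congʳ-mod c (*-congʳ-mod w₀ (%ℕ-≡-mod p (- c * w₀ ^ (e ∸ 1)))) ⟨
    - c * w₀ ^ (e ∸ 1) * w₀ + c      ≡⟨ rotate c (w₀ ^ (e ∸ 1)) w₀ ⟩
    - c * w₀ ^ e + c                 ≈⟨ +-congʳ-mod c (*-congˡ-mod (- c) (^e≡1 w₀-unit)) ⟩
    - c * 1ℤ + c                     ≡⟨ cancel c ⟩
    0ℤ                               ∎)
    where
    open ≡-mod-Reasoning P
    rotate : ∀ c X w → - c * X * w + c ≡ - c * (w * X) + c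
    rotate = solve-∀
    cancel : ∀ c → - c * 1ℤ + c ≡ 0ℤ
    cancel = solve-∀

  lift : ∀ j {u} → Unit u → ∃[ t ] a ^ t * u ≡ 1ℤ mod P ^ suc j
  lift zero {u} uu = let t , g^tu≡1 = generator uu in t , ≡-mod-∣ (∣-reflexive (ℤ.*-identityʳ P)) (begin
    a ^ t * u    ≈⟨ *-congʳ-mod u (^-cong-mod a≡g t) ⟩
    g ^ t * u    ≈⟨ g^tu≡1 ⟩
    1ℤ           ∎)
    where open ≡-mod-Reasoning P
  lift (suc j) {u} uu = N , a^Nu≡1
    where
    M = P ^ suc j
    t = proj₁ (lift j uu)
    a^tu≡1 = proj₂ (lift j uu)
    c = quotient (difference a^tu≡1)
    s = correction c
    N = e ℕ.* p ℕ.^ j ℕ.* s ℕ.+ t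
    a^tu≡ : a ^ t * u ≡ 1ℤ + M * c
    a^tu≡ = trans (≡-mod⇒≡+multiple a^tu≡1) (cong (_+_ 1ℤ) (ℤ.*-comm c M))
    P∣M : P ∣ M
    P∣M = ∣m⇒∣m*n (P ^ j) ∣-refl
    split : a ^ N * u ≡ ((a ^ e) ^ (p ℕ.^ j)) ^ s * (a ^ t * u)
    split = begin
      a ^ N * u                                   ≡⟨ cong (_* u) (ℤ.^-distribˡ-+-* a (e ℕ.* p ℕ.^ j ℕ.* s) t) ⟩
      a ^ (e ℕ.* p ℕ.^ j ℕ.* s) * a ^ t * u       ≡⟨ ℤ.*-assoc (a ^ (e ℕ.* p ℕ.^ j ℕ.* s)) (a ^ t) u ⟩
      a ^ (e ℕ.* p ℕ.^ j ℕ.* s) * (a ^ t * u)     ≡⟨ cong (_* (a ^ t * u)) (sym power-of-power) ⟩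
      ((a ^ e) ^ (p ℕ.^ j)) ^ s * (a ^ t * u)     ∎
      where
      open ≡-Reasoning
      power-of-power : ((a ^ e) ^ (p ℕ.^ j)) ^ s ≡ a ^ (e ℕ.* p ℕ.^ j ℕ.* s)
      power-of-power = trans (ℤ.^-*-assoc (a ^ e) (p ℕ.^ j) s)
        (trans (ℤ.^-*-assoc a e (p ℕ.^ j ℕ.* s)) (cong (a ^_) (sym (ℕ.*-assoc e (p ℕ.^ j) s))))
    error-vanishes : P ^ suc (suc j) ∣ M * (+ s * w₀ + c)
    error-vanishes = subst (_∣ M * (+ s * w₀ + c)) (ℤ.*-comm M P) (*-monoʳ-∣ M (P∣correction c))
    a^Nu≡1 : a ^ N * u ≡ 1ℤ mod P ^ suc (suc j)
    a^Nu≡1 = begin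
      a ^ N * u                                     ≡⟨ split ⟩
      ((a ^ e) ^ (p ℕ.^ j)) ^ s * (a ^ t * u)       ≈⟨ *-cong-mod (^-cong-mod (a^e^pʲ≡ j) s) (≡-mod-reflexive a^tu≡) ⟩
      (1ℤ + M * w₀) ^ s * (1ℤ + M * c)              ≈⟨ ≡-mod-∣ (∣-reflexive (ℤ.*-comm P M)) (binomial-correction w₀ c s P∣M) ⟩
      1ℤ + M * (+ s * w₀ + c)                       ≈⟨ +-∣ʳ-mod 1ℤ error-vanishes ⟩
      1ℤ                                            ∎
      where open ≡-mod-Reasoning (P ^ suc (suc j))

  record OddPrimitiveRoot (m : ℤ) : Set where
    field
      root           : ℤ
      root-odd       : Odd root
      root-unit      : Unit root
      root-generates : ∀ {u} → Unit u → ∃[ t ] root ^ t * u ≡ 1ℤ mod m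

  odd-primitive-root : ∀ k → 1 ≤ k → OddPrimitiveRoot (+ (p ℕ.^ k))
  odd-primitive-root (suc j) _ = subst OddPrimitiveRoot (sym (pos-^ p (suc j))) (adjust (+ 2 ∣? a))
    where
    generates : ∀ {b} → b ≡ a mod P ^ suc j → ∀ {u} → Unit u → ∃[ t ] b ^ t * u ≡ 1ℤ mod P ^ suc j
    generates {b} b≡a {u} uu = let t , a^tu≡1 = lift j uu in t , ≡-mod-trans (*-congʳ-mod u (^-cong-mod b≡a t)) a^tu≡1
    P-odd : Odd P
    P-odd 2∣P = p-odd (∣⇒∣ᵤ 2∣P)
    a-unit : Unit a
    a-unit = unit-resp (≡-mod-sym a≡g) g-unit
    adjust : Dec (+ 2 ∣ a) → OddPrimitiveRoot (P ^ suc j)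
    adjust (no a-odd) = record { root = a ; root-odd = a-odd ; root-unit = a-unit ; root-generates = generates ≡-mod-refl }
    adjust (yes 2∣a)  = record
      { root           = a + P ^ suc j
      ; root-odd       = λ 2∣b → ^-odd P-odd (suc j) (∣m+n∣m⇒∣n 2∣b 2∣a)
      ; root-unit      = unit-resp (≡-mod-sym (+-∣ʳ-mod a (∣m⇒∣m*n (P ^ j) ∣-refl))) a-unit
      ; root-generates = generates (+-∣ʳ-mod a ∣-refl)
      }

module Cycles where

  open import Defs
  open import Data.Nat as ℕ using (zero; suc; _+_; _*_; _∸_; _<_; >-nonZero)
  open import Data.Nat.DivMod using (_%_; _/_; m≡m%n+[m/n]*n; m%n<n)
  open import Data.Fin as Fin using (Fin; toℕ)
  import Data.Fin.Properties as Fin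
  open import Data.List as List using (List; []; _∷_; length; foldr; upTo; filterᵇ)
  open import Data.List.Membership.Propositional using (_∈_)
  open import Data.List.Membership.Propositional.Properties using (∈-upTo⁺; ∈-lookup; ∈-filter⁻)
  open import Data.List.Relation.Unary.All as All using (_∷_)
  open import Data.List.Relation.Unary.All.Properties using (all⁺)
  open import Data.List.Relation.Unary.Unique.Propositional using (Unique)
  open import Data.List.Relation.Unary.AllPairs using (_∷_)
  open import Data.List.Relation.Unary.Unique.Propositional.Properties using (allFin⁺; filter⁺)
  open import Data.Bool using (Bool; true; false; T; if_then_else_)

  count≡length-filterᵇ : ∀ {A : Set} (b : A → Bool) xs → foldr (λ x k → (if b x then 1 else 0) + k) 0 xs ≡ length (filterᵇ b xs)
  count≡length-filterᵇ b []       = refl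
  count≡length-filterᵇ b (x ∷ xs) with b x
  ... | true  = cong suc (count≡length-filterᵇ b xs)
  ... | false = count≡length-filterᵇ b xs

  lookup-injective : ∀ {A : Set} {xs : List A} → Unique xs → Injective _≡_ _≡_ (List.lookup xs)
  lookup-injective {xs = _ ∷ _} _              {Fin.zero}  {Fin.zero}  _  = refl
  lookup-injective {xs = _ ∷ _} (x∉xs ∷ _)     {Fin.zero}  {Fin.suc j} eq = contradiction eq (All.lookup x∉xs (∈-lookup j))
  lookup-injective {xs = _ ∷ _} (x∉xs ∷ _)     {Fin.suc i} {Fin.zero}  eq = contradiction (sym eq) (All.lookup x∉xs (∈-lookup i))
  lookup-injective {xs = _ ∷ _} (_ ∷ unique)   {Fin.suc i} {Fin.suc j} eq = cong Fin.suc (lookup-injective unique eq)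

  unique-length≤ : ∀ {A : Set} {m} {xs : List A} → Unique xs → (f : ∀ {x} → x ∈ xs → Fin m) →
                   (∀ {x y} (x∈ : x ∈ xs) (y∈ : y ∈ xs) → f x∈ ≡ f y∈ → x ≡ y) → length xs ≤ m
  unique-length≤ {xs = xs} unique f f-injective =
    Fin.injective⇒≤ (λ {i} {j} eq → lookup-injective unique (f-injective (∈-lookup i) (∈-lookup j) eq))

  module _ {n} (σ : Fin n → Fin n) where

    iter-+ : ∀ a b x → iter σ (a + b) x ≡ iter σ a (iter σ b x)
    iter-+ zero    b x = refl
    iter-+ (suc a) b x = cong σ (iter-+ a b x)

    iter-* : ∀ {d x} → iter σ d x ≡ x → ∀ c → iter σ (c * d) x ≡ x
    iter-* σᵈx≡x zero    = refl
    iter-* {d} {x} σᵈx≡x (suc c) = trans (iter-+ d (c * d) x) (trans (cong (iter σ d) (iter-* σᵈx≡x c)) σᵈx≡x)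

    cyc≡length-filter : cyc σ ≡ length (filterᵇ (isCycleMin σ) (List.allFin n))
    cyc≡length-filter = count≡length-filterᵇ (isCycleMin σ) (List.allFin n)

    cycleMin-≤ : ∀ {i} → T (isCycleMin σ i) → ∀ {s} → s < n → toℕ i ≤ toℕ (iter σ s i)
    cycleMin-≤ {i} min {s} s<n =
      ℕ.≤ᵇ⇒≤ (toℕ i) _ (All.lookup (all⁺ (λ s → toℕ i ℕ.≤ᵇ toℕ (iter σ s i)) (upTo n) min) (∈-upTo⁺ s<n))

  module _ {n} {σ : Fin n → Fin n} (σ-injective : Injective _≡_ _≡_ σ) where

    iter-injective : ∀ t → Injective _≡_ _≡_ (iter σ t)
    iter-injective zero    eq = eq
    iter-injective (suc t) eq = iter-injective t (σ-injective eq)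

    iter-periodic : ∀ x → ∃[ d ] 0 < d × d ≤ n × iter σ d x ≡ x
    iter-periodic x with Fin.pigeonhole (ℕ.n<1+n n) (λ i → iter σ (toℕ i) x)
    ... | i , j , i<j , σⁱx≡σʲx = toℕ j ∸ toℕ i , ℕ.m<n⇒0<n∸m i<j , d≤n , sym (iter-injective (toℕ i) σⁱx≡σᵈσⁱx)
      where
      d≤n : toℕ j ∸ toℕ i ≤ n
      d≤n = ℕ.≤-trans (ℕ.m∸n≤m (toℕ j) (toℕ i)) (ℕ.≤-pred (Fin.toℕ<n j))
      σⁱx≡σᵈσⁱx : iter σ (toℕ i) x ≡ iter σ (toℕ i) (iter σ (toℕ j ∸ toℕ i) x)
      σⁱx≡σᵈσⁱx = begin
        iter σ (toℕ i) x                                   ≡⟨ σⁱx≡σʲx ⟩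
        iter σ (toℕ j) x                                   ≡⟨ cong (λ s → iter σ s x) (ℕ.m+[n∸m]≡n (ℕ.<⇒≤ i<j)) ⟨
        iter σ (toℕ i + (toℕ j ∸ toℕ i)) x                 ≡⟨ iter-+ σ (toℕ i) _ x ⟩
        iter σ (toℕ i) (iter σ (toℕ j ∸ toℕ i) x)          ∎
        where open ≡-Reasoning

    orbit-returns : ∀ x t → ∃[ s ] iter σ s (iter σ t x) ≡ x
    orbit-returns x t with iter-periodic x
    ... | d , 0<d , _ , σᵈx≡x = t * d ∸ t , (begin
      iter σ (t * d ∸ t) (iter σ t x)    ≡⟨ iter-+ σ (t * d ∸ t) t x ⟨
      iter σ (t * d ∸ t + t) x           ≡⟨ cong (λ s → iter σ s x) (ℕ.m∸n+n≡m (ℕ.m≤m*n t d {{>-nonZero 0<d}})) ⟩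
      iter σ (t * d) x                   ≡⟨ iter-* σ σᵈx≡x t ⟩
      x                                  ∎)
      where open ≡-Reasoning

    orbit-bounded : ∀ x s → ∃[ r ] r < n × iter σ r x ≡ iter σ s x
    orbit-bounded x s with iter-periodic x
    ... | d , 0<d , d≤n , σᵈx≡x = s % d , ℕ.<-≤-trans (m%n<n s d) d≤n , sym (begin
      iter σ s x                               ≡⟨ cong (λ s → iter σ s x) (m≡m%n+[m/n]*n s d) ⟩
      iter σ (s % d + s / d * d) x             ≡⟨ iter-+ σ (s % d) _ x ⟩
      iter σ (s % d) (iter σ (s / d * d) x)    ≡⟨ cong (iter σ (s % d)) (iter-* σ σᵈx≡x (s / d)) ⟩
      iter σ (s % d) x                         ∎)
      where
      open ≡-Reasoning
      instance _ = >-nonZero 0<d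

    cycleMin-≤-orbit : ∀ {i i′} → T (isCycleMin σ i) → ∀ t t′ → iter σ t i ≡ iter σ t′ i′ → toℕ i ≤ toℕ i′
    cycleMin-≤-orbit {i} {i′} min t t′ eq with orbit-returns i′ t′
    ... | s , back with orbit-bounded i (s + t)
    ...   | r , r<n , σʳi≡ = subst (λ y → toℕ i ≤ toℕ y) σʳi≡i′ (cycleMin-≤ σ min r<n)
      where
      σʳi≡i′ : iter σ r i ≡ i′
      σʳi≡i′ = trans σʳi≡ (trans (iter-+ σ s t i) (trans (cong (iter σ s) eq) back))

    cycleMin-unique : ∀ {i i′} → T (isCycleMin σ i) → T (isCycleMin σ i′) → ∀ t t′ → iter σ t i ≡ iter σ t′ i′ → i ≡ i′
    cycleMin-unique min min′ t t′ eq =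
      Fin.toℕ-injective (ℕ.≤-antisym (cycleMin-≤-orbit min t t′ eq) (cycleMin-≤-orbit min′ t′ t (sym eq)))

    cyc≤ : ∀ {m} (C : Fin n → Set) (label : ∀ {y} → C y → Fin m) → (∀ x → ∃[ t ] C (iter σ t x)) →
           (∀ {y y′} (c : C y) (c′ : C y′) → label c ≡ label c′ → y ≡ y′) → cyc σ ≤ m
    cyc≤ {m} C label meets label-injective = subst (_≤ m) (sym (cyc≡length-filter σ))
      (unique-length≤ (filter⁺ (T? ∘ isCycleMin σ) (allFin⁺ n)) label-of label-of-injective)
      where
      minima = filterᵇ (isCycleMin σ) (List.allFin n)
      label-of : ∀ {i} → i ∈ minima → Fin m
      label-of {i} _ = label (proj₂ (meets i))
      minimal : ∀ {i} → i ∈ minima → T (isCycleMin σ i)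
      minimal = proj₂ ∘ ∈-filter⁻ (T? ∘ isCycleMin σ) {xs = List.allFin n}
      label-of-injective : ∀ {i i′} (i∈ : i ∈ minima) (i′∈ : i′ ∈ minima) → label-of i∈ ≡ label-of i′∈ → i ≡ i′
      label-of-injective {i} {i′} i∈ i′∈ eq = cycleMin-unique (minimal i∈) (minimal i′∈) (proj₁ (meets i)) (proj₁ (meets i′))
        (label-injective (proj₂ (meets i)) (proj₂ (meets i′)) eq)

open Cycles

module AllPermutations where

  open import Defs
  open import Data.Nat as ℕ using (suc; _+_; _∸_; _⊔_; _⊓_; NonZero)
  open import Data.Nat.DivMod using (_%_)
  open import Data.Fin as Fin using (Fin; toℕ; punchIn; punchOut)
  import Data.Fin.Properties as Fin
  open import Data.Fin.Permutation as Perm using (Permutation; _⟨$⟩ʳ_; _⟨$⟩ˡ_; remove)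
  open import Data.Vec as Vec using (Vec; []; _∷_; lookup; tabulate; insertAt)
  import Data.Vec.Properties as Vec
  open import Data.List as List using (List; _∷_; map; concatMap; upTo)
  open import Data.List.Membership.Propositional using (_∈_)
  open import Data.List.Membership.Propositional.Properties using (∈-map⁺; ∈-++⁺ˡ; ∈-++⁺ʳ)
  open import Data.List.Properties using (foldr-preservesᵇ; foldr-preservesᵒ)
  open import Data.List.Relation.Unary.Any as Any using (here; there)
  open import Data.List.Relation.Unary.All as All using (_∷_)
  open import Data.List.Relation.Unary.All.Properties using (map⁺)

  ∈-concatMap : ∀ {A B : Set} (f : A → List B) {xs x y} → x ∈ xs → y ∈ f x → y ∈ concatMap f xs
  ∈-concatMap f {x ∷ xs} (here refl) y∈ = ∈-++⁺ˡ y∈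
  ∈-concatMap f {x ∷ xs} (there x∈)  y∈ = ∈-++⁺ʳ (f x) (∈-concatMap f x∈ y∈)

  insertAt-∈-insertAll : ∀ {A : Set} {n} (x : A) (v : Vec A n) i → insertAt v i x ∈ insertAll x v
  insertAt-∈-insertAll x []       Fin.zero    = here refl
  insertAt-∈-insertAll x (y ∷ ys) Fin.zero    = here refl
  insertAt-∈-insertAll x (y ∷ ys) (Fin.suc i) = there (∈-map⁺ (y ∷_) (insertAt-∈-insertAll x ys i))

  permute-∈-vperms : ∀ {A : Set} {n} (v : Vec A n) (π : Permutation n n) → tabulate (lookup v ∘ (π ⟨$⟩ʳ_)) ∈ vperms v
  permute-∈-vperms []       π = here refl
  permute-∈-vperms {A} {suc m} (x ∷ xs) π =
    subst (_∈ vperms (x ∷ xs)) (sym permuted≡) (∈-concatMap (insertAll x) (permute-∈-vperms xs π′) (insertAt-∈-insertAll x w k))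
    where
    k : Fin (suc m)
    k = π ⟨$⟩ˡ Fin.zero
    π′ : Permutation m m
    π′ = remove k π
    w : Vec A m
    w = tabulate (lookup xs ∘ (π′ ⟨$⟩ʳ_))
    πk≡0 : π ⟨$⟩ʳ k ≡ Fin.zero
    πk≡0 = Perm.inverseʳ π
    pointwise : ∀ i → lookup (x ∷ xs) (π ⟨$⟩ʳ i) ≡ lookup (insertAt w k x) i
    pointwise i with k Fin.≟ i
    ... | yes refl = trans (cong (lookup (x ∷ xs)) πk≡0) (sym (Vec.insertAt-lookup w k x))
    ... | no  k≢i  = begin
      lookup (x ∷ xs) (π ⟨$⟩ʳ i)                         ≡⟨ cong (lookup (x ∷ xs) ∘ (π ⟨$⟩ʳ_)) (Fin.punchIn-punchOut k≢i) ⟨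
      lookup (x ∷ xs) (π ⟨$⟩ʳ punchIn k j)               ≡⟨ cong (lookup (x ∷ xs)) (Perm.punchIn-permute π k j) ⟩
      lookup (x ∷ xs) (punchIn (π ⟨$⟩ʳ k) (π′ ⟨$⟩ʳ j))   ≡⟨ cong (λ z → lookup (x ∷ xs) (punchIn z (π′ ⟨$⟩ʳ j))) πk≡0 ⟩
      lookup xs (π′ ⟨$⟩ʳ j)                              ≡⟨ Vec.lookup∘tabulate (lookup xs ∘ (π′ ⟨$⟩ʳ_)) j ⟨
      lookup w j                                         ≡⟨ Vec.insertAt-punchIn w k x j ⟨
      lookup (insertAt w k x) (punchIn k j)              ≡⟨ cong (lookup (insertAt w k x)) (Fin.punchIn-punchOut k≢i) ⟩
      lookup (insertAt w k x) i                          ∎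
      where
      open ≡-Reasoning
      j = punchOut k≢i
    permuted≡ : tabulate (lookup (x ∷ xs) ∘ (π ⟨$⟩ʳ_)) ≡ insertAt w k x
    permuted≡ = trans (Vec.tabulate-cong pointwise) (Vec.tabulate∘lookup (insertAt w k x))

  permutation-∈-allPerms : ∀ {n} (π : Permutation n n) → ∃[ g ] g ∈ allPerms n × (∀ i → g i ≡ π ⟨$⟩ʳ i)
  permutation-∈-allPerms {n} π =
    lookup table , ∈-map⁺ lookup (permute-∈-vperms (Vec.allFin n) π) ,
    λ i → trans (Vec.lookup∘tabulate _ i) (Vec.lookup-allFin (π ⟨$⟩ʳ i))
    where
    table = tabulate (lookup (Vec.allFin n) ∘ (π ⟨$⟩ʳ_))

  minSwaps≤t : ∀ {n} {g : Fin n → Fin n} → g ∈ allPerms n → minSwaps g ≤ t n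
  minSwaps≤t {n} {g} g∈ = foldr-preservesᵒ {P = minSwaps g ≤_} {f = _⊔_} bound 0 (map minSwaps (allPerms n))
    (inj₂ (Any.map ℕ.≤-reflexive (∈-map⁺ minSwaps g∈)))
    where
    bound : ∀ x y → minSwaps g ≤ x ⊎ minSwaps g ≤ y → minSwaps g ≤ x ⊔ y
    bound x y (inj₁ ≤x) = ℕ.≤-trans ≤x (ℕ.m≤m⊔n x y)
    bound x y (inj₂ ≤y) = ℕ.≤-trans ≤y (ℕ.m≤n⊔m x y)

  n∸c≤minSwaps : ∀ {n} (π : Fin n → Fin n) c → (∀ j → cyc (π ∘ cpow j) ≤ c) → n ∸ c ≤ minSwaps π
  n∸c≤minSwaps {n} π c cyc≤c = foldr-preservesᵇ {P = n ∸ c ≤_} {f = _⊓_} ℕ.⊓-glb (ℕ.m∸n≤m n c)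
    (map⁺ (All.universal (λ j → ℕ.∸-monoʳ-≤ n (cyc≤c j)) (upTo n)))

  toℕ-cpow : ∀ {N} .{{_ : NonZero N}} j (i : Fin N) → toℕ (cpow j i) ≡ (toℕ i + j) % N
  toℕ-cpow {suc _} j i = Fin.toℕ-fromℕ< _

open AllPermutations

module ShiftedMultiplication (p k : ℕ) (p-prime : Prime p) (p-odd : ¬ 2 ℕ.∣ p) (1≤k : 1 ≤ k)
  (root : Lifting.OddPrimitiveRoot p p-prime p-odd (+ (p ℕ.^ k))) where

  open import Defs
  open import Data.Nat as ℕ using (zero; suc; _<_; z≤n; s≤s; NonZero)
  open import Data.Integer using (_+_; _-_; _*_; _^_; 1ℤ; _%ℕ_)
  open import Data.Integer.DivMod using (n%ℕd<d)
  open import Data.Integer.Divisibility.Signed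
  open import Data.Fin as Fin using (Fin; toℕ; fromℕ<; combine; remQuot)
  import Data.Fin.Properties as Fin
  open import Data.Fin.Permutation as Perm using (Permutation; _⟨$⟩ʳ_)

  open ModPrime p p-prime
  open Lifting p p-prime p-odd using (P; 2<p)
  open Lifting.OddPrimitiveRoot root renaming (root to a; root-odd to a-odd; root-unit to a-unit; root-generates to a-generates)

  q n : ℕ
  q = p ℕ.^ k
  n = 2 ℕ.* q

  instance
    q≢0 : NonZero q
    q≢0 = ℕ.m^n≢0 p k
    n≢0 : NonZero n
    n≢0 = ℕ.m*n≢0 2 q

  Q N : ℤ
  Q = + q
  N = + n

  Q≡Pᵏ : Q ≡ P ^ k
  Q≡Pᵏ = pos-^ p k

  Q-odd : Odd Q
  Q-odd = subst Odd (sym Q≡Pᵏ) (^-odd (λ 2∣P → p-odd (∣⇒∣ᵤ 2∣P)) k)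

  mod-N⇒mod-Q : ∀ {x y} → x ≡ y mod N → x ≡ y mod Q
  mod-N⇒mod-Q = ≡-mod-∣ (divides (+ 2) (ℤ.pos-* 2 q))

  mod-Q⇒mod-P : ∀ {x y} → x ≡ y mod Q → x ≡ y mod P
  mod-Q⇒mod-P = ≡-mod-∣ (subst (P ∣_) (sym Q≡Pᵏ) (P∣Pᵏ k 1≤k))
    where
    P∣Pᵏ : ∀ k → 1 ≤ k → P ∣ P ^ k
    P∣Pᵏ (suc k) _ = ∣m⇒∣m*n (P ^ k) ∣-refl

  a⁻¹ : ℤ
  a⁻¹ = a ^ proj₁ (a-generates a-unit)

  a⁻¹*a≡1 : a⁻¹ * a ≡ 1ℤ mod N
  a⁻¹*a≡1 = subst (a⁻¹ * a ≡ 1ℤ mod_) (sym (ℤ.pos-* 2 q))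
    (≡-mod-2*odd Q-odd (odd⇒≡1-mod-2 (*-odd (^-odd a-odd (proj₁ (a-generates a-unit))) a-odd)) (proj₂ (a-generates a-unit)))

  a-1-unit : Unit (a - 1ℤ)
  a-1-unit P∣a-1 = 1-unit (difference (begin
    + 2              ≡⟨ cong (_* + 2) (ℤ.^-zeroˡ s) ⟨
    1ℤ ^ s * + 2     ≈⟨ *-congʳ-mod (+ 2) (^-cong-mod (congruent P∣a-1) s) ⟨
    a ^ s * + 2      ≈⟨ mod-Q⇒mod-P a^s2≡1 ⟩
    1ℤ               ∎))
    where
    open ≡-mod-Reasoning P
    s = proj₁ (a-generates (small-unit (s≤s z≤n) 2<p))
    a^s2≡1 = proj₂ (a-generates (small-unit (s≤s z≤n) 2<p))

  [a-1]⁻¹ : ℤ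
  [a-1]⁻¹ = a ^ proj₁ (a-generates a-1-unit)

  [a-1]⁻¹*[a-1]≡1 : [a-1]⁻¹ * (a - 1ℤ) ≡ 1ℤ mod Q
  [a-1]⁻¹*[a-1]≡1 = proj₂ (a-generates a-1-unit)

  mul : ℤ → Fin n → Fin n
  mul m x = fromℕ< (n%ℕd<d (m * + toℕ x) n)

  toℕ-mul : ∀ m x → + toℕ (mul m x) ≡ m * + toℕ x mod N
  toℕ-mul m x = subst (_≡ m * + toℕ x mod N) (cong +_ (sym (Fin.toℕ-fromℕ< _))) (≡-mod-sym (%ℕ-≡-mod n (m * + toℕ x)))

  toℕ-≡-mod⇒≡ : ∀ {x y : Fin n} → + toℕ x ≡ + toℕ y mod N → x ≡ y
  toℕ-≡-mod⇒≡ {x} {y} x≡y = Fin.toℕ-injective (≡-mod⇒≡ n (Fin.toℕ<n x) (Fin.toℕ<n y) x≡y)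

  mul-inverse : ∀ {l m} → l * m ≡ 1ℤ mod N → ∀ x → mul l (mul m x) ≡ x
  mul-inverse {l} {m} lm≡1 x = toℕ-≡-mod⇒≡ (begin
    + toℕ (mul l (mul m x))    ≈⟨ toℕ-mul l (mul m x) ⟩
    l * + toℕ (mul m x)        ≈⟨ *-congˡ-mod l (toℕ-mul m x) ⟩
    l * (m * + toℕ x)          ≡⟨ ℤ.*-assoc l m (+ toℕ x) ⟨
    l * m * + toℕ x            ≈⟨ *-congʳ-mod (+ toℕ x) lm≡1 ⟩
    1ℤ * + toℕ x               ≡⟨ ℤ.*-identityˡ (+ toℕ x) ⟩
    + toℕ x                    ∎)
    where open ≡-mod-Reasoning N

  a*a⁻¹≡1 : a * a⁻¹ ≡ 1ℤ mod N
  a*a⁻¹≡1 = subst (_≡ 1ℤ mod N) (ℤ.*-comm a⁻¹ a) a⁻¹*a≡1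

  π : Permutation n n
  π = Perm.permutation (mul a) (mul a⁻¹) (mul-inverse {a} {a⁻¹} a*a⁻¹≡1) (mul-inverse {a⁻¹} {a} a⁻¹*a≡1)

  toℕ-≡-remainder : ∀ y → + toℕ y ≡ + toℕ (proj₂ (remQuot {2} q y)) mod Q
  toℕ-≡-remainder y = subst (_≡ + toℕ lo mod Q) (cong (+_ ∘ toℕ) (Fin.combine-remQuot {2} q y)) (begin
    + toℕ (combine hi lo)          ≡⟨ cong +_ (Fin.toℕ-combine hi lo) ⟩
    + (q ℕ.* toℕ hi ℕ.+ toℕ lo)    ≡⟨ ℤ.pos-+ (q ℕ.* toℕ hi) (toℕ lo) ⟩
    + (q ℕ.* toℕ hi) + + toℕ lo    ≡⟨ ℤ.+-comm (+ (q ℕ.* toℕ hi)) (+ toℕ lo) ⟩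
    + toℕ lo + + (q ℕ.* toℕ hi)    ≡⟨ cong (_+_ (+ toℕ lo)) (trans (ℤ.pos-* q (toℕ hi)) (ℤ.*-comm Q (+ toℕ hi))) ⟩
    + toℕ lo + + toℕ hi * Q        ≈⟨ +-multiple-mod (+ toℕ lo) (+ toℕ hi) ⟩
    + toℕ lo                       ∎)
    where
    open ≡-mod-Reasoning Q
    hi = proj₁ (remQuot {2} q y)
    lo = proj₂ (remQuot {2} q y)

  module Shift (j : ℕ) (σ : Fin n → Fin n) (σ-spec : ∀ y → + toℕ (σ y) ≡ a * (+ toℕ y + + j) mod N) where

    σ-injective : Injective _≡_ _≡_ σ
    σ-injective {x} {y} σx≡σy = toℕ-≡-mod⇒≡ (+-cancelʳ-mod (+ j) (*-cancelˡ-mod-inverse a⁻¹ a a⁻¹*a≡1 (begin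
      a * (+ toℕ x + + j)    ≈⟨ σ-spec x ⟨
      + toℕ (σ x)            ≡⟨ cong (+_ ∘ toℕ) σx≡σy ⟩
      + toℕ (σ y)            ≈⟨ σ-spec y ⟩
      a * (+ toℕ y + + j)    ∎)))
      where open ≡-mod-Reasoning N

    -- σ(y) = a(y + j) fixes y* = −aj/(a − 1), and κ(y) = (a − 1)(y − y*) is the coordinate centred
    -- at y*, in which σ is multiplication by a.
    κ : Fin n → ℤ
    κ y = (a - 1ℤ) * + toℕ y + a * + j

    κ-σ : ∀ y → κ (σ y) ≡ a * κ y mod Q
    κ-σ y = mod-N⇒mod-Q (begin
      (a - 1ℤ) * + toℕ (σ y) + a * + j            ≈⟨ +-congʳ-mod (a * + j) (*-congˡ-mod (a - 1ℤ) (σ-spec y)) ⟩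
      (a - 1ℤ) * (a * (+ toℕ y + + j)) + a * + j  ≡⟨ commute a (+ toℕ y) (+ j) ⟩
      a * κ y                                      ∎)
      where
      open ≡-mod-Reasoning N
      commute : ∀ a y j → (a - 1ℤ) * (a * (y + j)) + a * j ≡ a * ((a - 1ℤ) * y + a * j)
      commute = solve-∀

    κ-iter : ∀ t y → κ (iter σ t y) ≡ a ^ t * κ y mod Q
    κ-iter zero    y = ≡-mod-reflexive (sym (ℤ.*-identityˡ (κ y)))
    κ-iter (suc t) y = begin
      κ (σ (iter σ t y))       ≈⟨ κ-σ (iter σ t y) ⟩
      a * κ (iter σ t y)       ≈⟨ *-congˡ-mod a (κ-iter t y) ⟩
      a * (a ^ t * κ y)        ≡⟨ ℤ.*-assoc a (a ^ t) (κ y) ⟨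
      a ^ suc t * κ y          ∎
      where open ≡-mod-Reasoning Q

    Canonical : Fin n → Set
    Canonical y = ∃[ i ] i ≤ k × κ y ≡ P ^ i mod Q

    -- proj₁ (remQuot q y) is the half y / q ∈ {0, 1} of Fin n containing y.
    label : ∀ {y} → Canonical y → Fin (suc k ℕ.* 2)
    label {y} (i , i≤k , _) = combine (fromℕ< (s≤s i≤k)) (proj₁ (remQuot {2} q y))

    label-injective : ∀ {y y′} (c : Canonical y) (c′ : Canonical y′) → label c ≡ label c′ → y ≡ y′
    label-injective {y} {y′} (i , i≤k , κy≡) (i′ , i′≤k , κy′≡) same = begin
      y                                  ≡⟨ Fin.combine-remQuot {2} q y ⟨
      combine (proj₁ (remQuot q y)) lo   ≡⟨ cong₂ combine same-hi same-lo ⟩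
      combine (proj₁ (remQuot q y′)) lo′ ≡⟨ Fin.combine-remQuot {2} q y′ ⟩
      y′                                 ∎
      where
      open ≡-Reasoning
      lo = proj₂ (remQuot {2} q y)
      lo′ = proj₂ (remQuot {2} q y′)
      same-hi : proj₁ (remQuot {2} q y) ≡ proj₁ (remQuot {2} q y′)
      same-hi = Fin.combine-injectiveʳ (fromℕ< (s≤s i≤k)) _ (fromℕ< (s≤s i′≤k)) _ same
      same-i : i ≡ i′
      same-i = trans (sym (Fin.toℕ-fromℕ< (s≤s i≤k)))
        (trans (cong toℕ (Fin.combine-injectiveˡ (fromℕ< (s≤s i≤k)) _ (fromℕ< (s≤s i′≤k)) _ same)) (Fin.toℕ-fromℕ< (s≤s i′≤k)))
      κy≡κy′ : κ y ≡ κ y′ mod Q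
      κy≡κy′ = ≡-mod-trans κy≡ (subst (λ i → P ^ i ≡ κ y′ mod Q) (sym same-i) (≡-mod-sym κy′≡))
      y≡y′ : + toℕ y ≡ + toℕ y′ mod Q
      y≡y′ = *-cancelˡ-mod-inverse [a-1]⁻¹ (a - 1ℤ) [a-1]⁻¹*[a-1]≡1 (+-cancelʳ-mod (a * + j) κy≡κy′)
      same-lo : lo ≡ lo′
      same-lo = Fin.toℕ-injective (≡-mod⇒≡ q (Fin.toℕ<n lo) (Fin.toℕ<n lo′)
        (≡-mod-trans (≡-mod-sym (toℕ-≡-remainder y)) (≡-mod-trans y≡y′ (toℕ-≡-remainder y′))))

    meets-canonical : ∀ x → ∃[ t ] Canonical (iter σ t x)
    meets-canonical x = from-residue (κ x %ℕ q) (%ℕ-≡-mod q (κ x)) (n%ℕd<d (κ x) q)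
      where
      from-residue : ∀ r → κ x ≡ + r mod Q → r < q → ∃[ t ] Canonical (iter σ t x)
      from-residue zero κx≡0 _ = 0 , k , ℕ.≤-refl , ≡-mod-trans κx≡0 (≡-mod-sym (∣⇒≡0-mod (∣-reflexive Q≡Pᵏ)))
      from-residue r@(suc _) κx≡r r<q = power-part (factor-out 2≤p r)
        where
        power-part : ∃[ i ] ∃[ u ] r ≡ p ℕ.^ i ℕ.* u × ¬ p ℕ.∣ u → ∃[ t ] Canonical (iter σ t x)
        power-part (i , u , r≡pⁱu , p∤u) = s , i , i≤k , (begin
          κ (iter σ s x)         ≈⟨ κ-iter s x ⟩
          a ^ s * κ x            ≈⟨ *-congˡ-mod (a ^ s) κx≡r ⟩
          a ^ s * + r            ≡⟨ cong (a ^ s *_) r≡Pⁱu ⟩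
          a ^ s * (P ^ i * + u)  ≡⟨ swap (a ^ s) (P ^ i) (+ u) ⟩
          P ^ i * (a ^ s * + u)  ≈⟨ *-congˡ-mod (P ^ i) a^su≡1 ⟩
          P ^ i * 1ℤ             ≡⟨ ℤ.*-identityʳ (P ^ i) ⟩
          P ^ i                  ∎)
          where
          open ≡-mod-Reasoning Q
          u-unit : Unit (+ u)
          u-unit P∣u = p∤u (∣⇒∣ᵤ P∣u)
          s = proj₁ (a-generates u-unit)
          a^su≡1 = proj₂ (a-generates u-unit)
          r≡Pⁱu : + r ≡ P ^ i * + u
          r≡Pⁱu = trans (cong +_ r≡pⁱu) (trans (ℤ.pos-* (p ℕ.^ i) u) (cong (_* + u) (pos-^ p i)))
          swap : ∀ x y z → x * (y * z) ≡ y * (x * z)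
          swap = solve-∀
          i≤k : i ≤ k
          i≤k = ℕ.≮⇒≥ λ k<i → ℕ.<⇒≱ r<q (ℕ.≤-trans (ℕ.^-monoʳ-≤ p (ℕ.<⇒≤ k<i))
                  (ℕ.≤-trans (ℕ.m≤m*n (p ℕ.^ i) u {{ℕ.m*n≢0⇒n≢0 (p ℕ.^ i) {{subst NonZero r≡pⁱu _}}}}) (ℕ.≤-reflexive (sym r≡pⁱu))))

    cyc≤2k+2 : cyc σ ≤ 2 ℕ.* k ℕ.+ 2
    cyc≤2k+2 = subst (cyc σ ≤_) (trans (ℕ.+-comm 2 (k ℕ.* 2)) (cong (ℕ._+ 2) (ℕ.*-comm k 2)))
      (cyc≤ σ-injective Canonical label meets-canonical label-injective)

  cyc-shifted≤ : ∀ {g} → (∀ x → g x ≡ π ⟨$⟩ʳ x) → ∀ j → cyc (g ∘ cpow j) ≤ 2 ℕ.* k ℕ.+ 2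
  cyc-shifted≤ {g} g≗π j = Shift.cyc≤2k+2 j (g ∘ cpow j) shifted-spec
    where
    shifted-spec : ∀ y → + toℕ (g (cpow j y)) ≡ a * (+ toℕ y + + j) mod N
    shifted-spec y = begin
      + toℕ (g (cpow j y))              ≡⟨ cong (+_ ∘ toℕ) (g≗π (cpow j y)) ⟩
      + toℕ (mul a (cpow j y))          ≈⟨ toℕ-mul a (cpow j y) ⟩
      a * + toℕ (cpow j y)              ≡⟨ cong (λ m → a * + m) (toℕ-cpow j y) ⟩
      a * + ((toℕ y ℕ.+ j) ℕ.% n)       ≈⟨ *-congˡ-mod a (%ℕ-≡-mod n (+ (toℕ y ℕ.+ j))) ⟨
      a * + (toℕ y ℕ.+ j)               ≡⟨ cong (a *_) (ℤ.pos-+ (toℕ y) j) ⟩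
      a * (+ toℕ y + + j)               ∎
      where open ≡-mod-Reasoning N

open import Defs
open import Data.Nat using (ℕ; _+_; _*_; _∸_; _^_; _≤_)
open import Data.Nat.Divisibility using (_∣_)
open import Data.Nat.Primality using (Prime)
open import Relation.Nullary using (¬_)

proposition3p7 : (p k : ℕ) → Prime p → ¬ (2 ∣ p) → 1 ≤ k →
    2 * p ^ k ∸ (2 * k + 2) ≤ t (2 * p ^ k)
proposition3p7 p k p-prime p-odd 1≤k =
  let g , g∈allPerms , g≗π = permutation-∈-allPerms π
  in ℕ.≤-trans (n∸c≤minSwaps g (2 * k + 2) (cyc-shifted≤ g≗π)) (minSwaps≤t g∈allPerms)
  where open ShiftedMultiplication p k p-prime p-odd 1≤k (Lifting.odd-primitive-root p p-prime p-odd k 1≤k)
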